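{- Let $0 \le l < n$ be integers, and let $\hat{R}_{n,l}$ be the poset $R_{n,l}$ with a new minimum $\hat{0}$ and a new maximum $\hat{1}$ adjoined. Let $\Lambda_{n,l}$ be the disjoint union of $\{\alpha,\beta\}\times[l+1]\times[n+1]$ and $\binom{[n]}{l+1}$, totally ordered by $\preceq$ as follows: $(\alpha,\ast,\ast)\prec I\prec(\beta,\ast,\ast)$ for every $I\in\binom{[n]}{l+1}$; $(\alpha,i,\ast)\prec(\alpha,j,\ast)$ and $(\beta,i,\ast)\succ(\beta,j,\ast)$ whenever $i<j$ in $[l+1]$; $(\alpha,i,a)\prec(\alpha,i,b)$ and $(\beta,i,a)\prec(\beta,i,b)$ whenever $a<b$ in $[n+1]$; and $\binom{[n]}{l+1}$ is ordered lexicographically, $\{1,\dots,l+1\}\prec\cdots\prec\{n-l,\dots,n\}$ (here $\ast$ denotes an arbitrary entry). Define an edge labeling $\lambda$ of the Hasse diagram of $\hat{R}_{n,l}$ with values in $\Lambda_{n,l}$ by: (i) $\lambda(\hat{0}\lessdot(\{a_1\},\dots,\{a_{l+1}\})) := \{a_1,\dots,a_{l+1}\}$; (ii) if $\hat{0}<x\lessdot y<\hat{1}$ with $x=(A_1,\dots,A_{l+1})$, then $y$ is obtained from $x$ by adding some element $a\notin A_i$ with $\max(A_{i-1})<a<\min(A_{i+1})$ to the $i$th block $A_i$ (with the conventions $\max(\emptyset)$, $\min(\emptyset)$ imposing no condition for $A_0=A_{l+2}=\emptyset$); set $\gamma=\alpha$ if $a<\max(A_i)$ and $\gamma=\beta$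 if $a>\max(A_i)$, and define $\lambda(x\lessdot y):=(\gamma,i,a)$; (iii) $\lambda(x\lessdot\hat{1}):=(\beta,l+1,n+1)$. Then $\lambda$ is an EL-labeling of $\hat{R}_{n,l}$.
   Context: For $n\in\mathbb{N}$, $[n]=\{1,\dots,n\}$ and $\binom{[n]}{k}$ is the set of $k$-element subsets of $[n]$. For $0\le l<n$, $R_{n,l}$ is the poset whose elements are $(l+1)$-tuples $(A_1,\dots,A_{l+1})$ of nonempty subsets of $[n]$ (called blocks) such that $\max(A_i)<\min(A_{i+1})$ for all $i\in[l]$, ordered by componentwise containment: $(A_1,\dots,A_{l+1})\le(B_1,\dots,B_{l+1})$ iff $A_i\subseteq B_i$ for all $i$. (Equivalently, $R_{n,l}$ is the poset of projective sign vectors of length $n$ with exactly $l$ sign changes.) $\hat{R}_{n,l}$ is a finite graded poset. An edge labeling of a finite graded poset $P$ is a function from the cover relations of $P$ to a poset $(\Lambda,\preceq)$; a saturated chain $x_0\lessdot x_1\lessdot\cdots\lessdot x_r$ is increasing if $\lambda(x_0\lessdot x_1)\prec\lambda(x_1\lessdot x_2)\prec\cdots\prec\lambda(x_{r-1}\lessdot x_r)$ (strictly). $\lambda$ is an EL-labeling if for every closed interval $[x,y]$ of $P$: (EL1) there is a unique increasing maximal chain $C_0$ in $[x,y]$; and (EL2) if $x\lessdot z\le y$ with $z\ne x_1$, where $x\lessdot x_1$ is the first edge of $C_0$, then $\lambda(x\lessdot x_1)\prec\lambda(x\lessdot z)$. -}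

module Defs where

open import Data.Nat as ℕ using (ℕ; zero; suc)
open import Data.Fin as Fin using (Fin; zero; suc; inject₁; fromℕ)
open import Data.Fin.Properties using (any?; _≟_)
open import Data.Fin.Subset using (Subset; _∈_; _∉_; _⊆_; ⋃; ∣_∣; Nonempty)
open import Data.Fin.Subset.Properties using (_∈?_)
open import Data.Vec as Vec using (Vec; []; _∷_; lookup; toList)
open import Data.List as List using (List; []; _∷_)
open import Data.List.Relation.Binary.Lex.Strict using (Lex-<)
open import Data.Bool using (Bool; true; false; not; _∧_; if_then_else_)
open import Data.Maybe using (Maybe; just; nothing)
import Data.Maybe as Maybe
open import Data.Product using (Σ; ∃; _×_; _,_; proj₁)
open import Data.Sum using (_⊎_)
open import Data.Unit using (⊤)
open import Data.Empty using (⊥)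
open import Relation.Nullary using (¬_; Dec; yes; no)
open import Relation.Nullary.Decidable using (⌊_⌋; _×-dec_)
open import Relation.Binary.PropositionalEquality using (_≡_; _≢_)

-- A poset is given by a carrier P with
-- an order relation _≤_ ; labels live in Λ with a strict order _≺_ ;
-- an edge labeling is a function lab : P → P → Λ of which only the
-- values on cover relations x ⋖ y are ever used.

module _ {P : Set} (_≤_ : P → P → Set) where

  _<ₚ_ : P → P → Set
  x <ₚ y = x ≤ y × x ≢ y

  _⋖_ : P → P → Set
  x ⋖ y = x <ₚ y × (¬ Σ P (λ z → x <ₚ z × z <ₚ y))

  IsMaxChain : P → List P → P → Set
  IsMaxChain x [] y = x ≡ y
  IsMaxChain x (z ∷ zs) y = x ⋖ z × IsMaxChain z zs y

module _ {P Λ : Set} (_≤_ : P → P → Set) (_≺_ : Λ → Λ → Set)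
         (lab : P → P → Λ) where

  IsIncreasing : P → List P → Set
  IsIncreasing x [] = ⊤
  IsIncreasing x (z ∷ []) = ⊤
  IsIncreasing x (z ∷ w ∷ zs) = (lab x z ≺ lab z w) × IsIncreasing z (w ∷ zs)

  EL2 : P → List P → P → Set
  EL2 x [] y = ⊤
  EL2 x (x₁ ∷ _) y =
    ∀ z → _⋖_ _≤_ x z → z ≤ y → z ≢ x₁ → lab x x₁ ≺ lab x z

  IsELLabeling : Set
  IsELLabeling =
    ∀ x y → x ≤ y →
      Σ (List P) λ C₀ →
        IsMaxChain _≤_ x C₀ y × IsIncreasing x C₀
        × (∀ C → IsMaxChain _≤_ x C y → IsIncreasing x C → C ≡ C₀)
        × EL2 x C₀ y

-- The poset R_{n,l}.  [n] is modelled by Fin n (0-based, same order),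
-- the block index set [l+1] by Fin (suc l).

module _ (n l : ℕ) where

  -- Proof fields are irrelevant, so elements are equal iff blocks are.
  record R : Set where
    constructor mkR
    field
      blocks   : Vec (Subset n) (suc l)
      .nonempty : ∀ (i : Fin (suc l)) → Nonempty (lookup blocks i)
      .ordered  : ∀ (i : Fin l) (a b : Fin n) →
                  a ∈ lookup blocks (inject₁ i) → b ∈ lookup blocks (suc i) →
                  a Fin.< b
  open R public

  _≤R_ : R → R → Set
  x ≤R y = ∀ (i : Fin (suc l)) → lookup (blocks x) i ⊆ lookup (blocks y) i

  data RHat : Set where
    𝟘 : RHat
    ⟨_⟩ : R → RHat
    𝟙 : RHat

  _≤̂_ : RHat → RHat → Set
  𝟘 ≤̂ _ = ⊤
  ⟨ x ⟩ ≤̂ 𝟘 = ⊥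
  ⟨ x ⟩ ≤̂ ⟨ y ⟩ = x ≤R y
  ⟨ x ⟩ ≤̂ 𝟙 = ⊤
  𝟙 ≤̂ 𝟙 = ⊤
  𝟙 ≤̂ _ = ⊥

  data Λ : Set where
    α : Fin (suc l) → Fin (suc n) → Λ
    ι : (I : Subset n) → .(∣ I ∣ ≡ suc l) → Λ
    β : Fin (suc l) → Fin (suc n) → Λ

  elems : ∀ {m} → Subset m → List (Fin m)
  elems [] = []
  elems (true ∷ s) = zero ∷ List.map suc (elems s)
  elems (false ∷ s) = List.map suc (elems s)

  _≺_ : Λ → Λ → Set
  α i a ≺ α j b = i Fin.< j ⊎ (i ≡ j × a Fin.< b)
  α _ _ ≺ ι _ _ = ⊤
  α _ _ ≺ β _ _ = ⊤
  ι _ _ ≺ α _ _ = ⊥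
  ι I _ ≺ ι J _ = Lex-< _≡_ Fin._<_ (elems I) (elems J)
  ι _ _ ≺ β _ _ = ⊤
  β _ _ ≺ α _ _ = ⊥
  β _ _ ≺ ι _ _ = ⊥
  β i a ≺ β j b = j Fin.< i ⊎ (i ≡ j × a Fin.< b)

  -- The edge labeling λ.  Values on non-covers are irrelevant (junk).

  junk : Λ
  junk = α zero zero

  firstNew : ∀ {m} → Subset m → Subset m → Maybe (Fin m)
  firstNew [] [] = nothing
  firstNew (a ∷ as) (b ∷ bs) =
    if not a ∧ b then just zero else Maybe.map suc (firstNew as bs)

  newIn : ∀ {k} → Vec (Subset n) k → Vec (Subset n) k → Maybe (Fin k × Fin n)
  newIn [] [] = nothing
  newIn (A ∷ As) (B ∷ Bs) with firstNew A B
  ... | just a = just (zero , a)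
  ... | nothing = Maybe.map (λ { (i , a) → (suc i , a) }) (newIn As Bs)

  -- a < max(A)  (A nonempty)  ⇔  some b ∈ A has a < b
  belowMax : Fin n → Subset n → Bool
  belowMax a A = ⌊ any? (λ b → (b ∈? A) ×-dec (a Fin.<? b)) ⌋

  lab : RHat → RHat → Λ
  lab 𝟘 ⟨ x ⟩ with ∣ ⋃ (toList (blocks x)) ∣ ℕ.≟ suc l
  ... | yes p = ι (⋃ (toList (blocks x))) p
  ... | no _ = junk
  lab ⟨ x ⟩ ⟨ y ⟩ with newIn (blocks x) (blocks y)
  ... | nothing = junk
  ... | just (i , a) =
          if belowMax a (lookup (blocks x) i)
          then α i (inject₁ a) else β i (inject₁ a)
  lab ⟨ x ⟩ 𝟙 = β (fromℕ l) (fromℕ n)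
  lab _ _ = junk

-- In every interval [x , y] of R̂ the cover of x with the least label is unique, and the chain
-- of successive least covers is the only increasing maximal chain: it is increasing, and a chain
-- leaving x through any other cover z already fails to increase at z, because the least label
-- above z is not larger. Above an element x of R a cover adds one element a to a block i, with
-- label (α , i , a) or (β , i , a); adding further elements can only turn a β-label into an
-- α-label, which drives both comparisons. Above 𝟘 the covers are the atoms: the least one below
-- y consists of the minima of the blocks of y (of {1},…,{l+1} below 𝟙), everything added to it
-- gets a β-label, and every other atom can still take the element where it first differs from
-- it, which gives it an α-labelled cover.

module Submission where

open import Defs
open import Data.Nat as ℕ using (ℕ; zero; suc; _+_; _<_; z≤n; s≤s)
import Data.Nat.Properties as ℕ
open import Data.Fin as Fin using (Fin; zero; suc; inject₁; toℕ; fromℕ)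
import Data.Fin.Properties as Fin
open import Data.Fin.Relation.Unary.Top using (view; ‵fromℕ; ‵inject₁)
open import Data.Fin.Subset using (Subset; _∈_; _∉_; _⊆_; _⊂_; _∪_; ⁅_⁆; ⋃; ∣_∣; Nonempty)
open import Data.Fin.Subset.Properties
  using (_∈?_; _⊆?_; nonempty?; ∉⊥; x∈p∪q⁻; x∈p∪q⁺; x∈⁅x⁆; x∈⁅y⁆⇒x≡y; ∣⁅x⁆∣≡1; ∣⊥∣≡0; drop-there; ⊆-antisym
        ; p⊂q⇒∣p∣<∣q∣; ∣p∣≤n)
open import Data.Vec as Vec using (Vec; []; _∷_; here; there; lookup; toList; tabulate; updateAt)
import Data.Vec.Properties as Vec
open import Data.List as List using (List; []; _∷_)
open import Data.List.Membership.Propositional using () renaming (_∈_ to _∈ᴸ_)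
open import Data.List.Membership.Propositional.Properties using (∈-cartesianProduct⁺; ∈-allFin)
import Data.List.Relation.Unary.Any as Any
open import Data.List.Relation.Binary.Lex.Strict as ListLex using (Lex-<)
open import Data.List.Relation.Binary.Lex.Core as LexCore using (this; next; halt)
open import Data.Bool using (true; false; not; _∧_; if_then_else_)
import Data.Bool.Properties as Bool
open import Data.Maybe using (just; nothing)
open import Data.Product using (Σ; ∃; ∃₂; _×_; _,_; proj₁; proj₂; uncurry)
import Data.Product.Properties as Product
open import Data.Product.Relation.Binary.Lex.Strict using (×-isStrictTotalOrder)
open import Data.Sum using (_⊎_; inj₁; inj₂)
open import Data.Unit using (⊤; tt)
open import Data.Empty using (⊥; ⊥-elim)
open import Function using (_∘_)
open import Relation.Nullary using (¬_; Dec; yes; no; ¬?)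
open import Relation.Nullary.Decidable
  using (recompute; map′; _×-dec_; _→-dec_; decidable-stable; dec-true; dec-false; isYes≗does)
open import Relation.Binary.Definitions using (DecidableEquality; tri<; tri≈; tri>)
open import Relation.Binary.Structures using (IsStrictTotalOrder)
import Relation.Binary.Construct.Flip.EqAndOrd as Flip
import Relation.Binary.Construct.StrictToNonStrict as StrictToNonStrict
open import Relation.Binary.PropositionalEquality
  using (_≡_; _≢_; refl; sym; trans; cong; cong₂; subst; subst₂; isEquivalence; resp₂)

-- EL-labelings from least covers

module LeastCoverCriterion
  {P Λ : Set} (_≤_ : P → P → Set) (_≺_ : Λ → Λ → Set) (lab : P → P → Λ)
  (≤-refl : ∀ {x} → x ≤ x)
  (≤-trans : ∀ {x y z} → x ≤ y → y ≤ z → x ≤ z)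
  (≤-antisym : ∀ {x y} → x ≤ y → y ≤ x → x ≡ y)
  (_≟_ : DecidableEquality P)
  (rank : P → ℕ) (rank-mono : ∀ {x y} → x ≤ y → x ≢ y → rank x ℕ.< rank y)
  where

  private
    _⋖ₚ_ = _⋖_ _≤_
    Increasing = IsIncreasing _≤_ _≺_ lab
    MaxChain = IsMaxChain _≤_

  record LeastCover (x y m : P) : Set where
    field
      cover : x ⋖ₚ m
      below : m ≤ y
      least : ∀ z → x ⋖ₚ z → z ≤ y → z ≢ m → lab x m ≺ lab x z

  least-cover⇒≢ : ∀ {x y m} → LeastCover x y m → x ≢ y
  least-cover⇒≢ lc refl = proj₂ (proj₁ cover) (≤-antisym (proj₁ (proj₁ cover)) below)
    where open LeastCover lc

  least-label-≼ : ∀ {x y m z} → LeastCover x y m → x ⋖ₚ z → z ≤ y → lab x m ≺ lab x z ⊎ lab x m ≡ lab x z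
  least-label-≼ {m = m} {z} lc x⋖z z≤y with z ≟ m
  ... | yes refl = inj₂ refl
  ... | no z≢m = inj₁ (LeastCover.least lc z x⋖z z≤y z≢m)

  least-cover-unique : (∀ {u v} → u ≺ v → ¬ v ≺ u) →
                       ∀ {x y m m′} → LeastCover x y m → LeastCover x y m′ → m ≡ m′
  least-cover-unique ≺-asym {m = m} {m′} lc lc′ with m ≟ m′
  ... | yes m≡m′ = m≡m′
  ... | no m≢m′ = ⊥-elim (≺-asym (least lc m′ (cover lc′) (below lc′) (m≢m′ ∘ sym))
                                 (least lc′ m (cover lc) (below lc) m≢m′))
    where open LeastCover

  maxChain⇒≤ : ∀ {x} C {y} → MaxChain x C y → x ≤ y
  maxChain⇒≤ [] refl = ≤-refl
  maxChain⇒≤ (z ∷ C) (((x≤z , _) , _) , ch) = ≤-trans x≤z (maxChain⇒≤ C ch)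

  increasing-tail : ∀ {x z} D → Increasing x (z ∷ D) → Increasing z D
  increasing-tail [] _ = tt
  increasing-tail (_ ∷ _) (_ , inc) = inc

  StartsWithLeastCover : P → P → List P → Set
  StartsWithLeastCover x y [] = x ≡ y
  StartsWithLeastCover x y (m ∷ _) = LeastCover x y m

  record UniqueIncreasingChain (x y : P) : Set where
    field
      chain : List P
      maximal : MaxChain x chain y
      increasing : Increasing x chain
      unique : ∀ C → MaxChain x C y → Increasing x C → C ≡ chain
      starts : StartsWithLeastCover x y chain

  empty-chain : ∀ x → UniqueIncreasingChain x x
  empty-chain x = record
    { chain = [] ; maximal = refl ; increasing = tt ; unique = unique ; starts = refl }
    where
    unique : ∀ C → MaxChain x C x → Increasing x C → C ≡ []
    unique [] _ _ = refl
    unique (z ∷ D) (((x≤z , x≢z) , _) , ch) _ = ⊥-elim (x≢z (≤-antisym x≤z (maxChain⇒≤ D ch)))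

  module _
    (least-cover-exists : ∀ {x y} → x ≤ y → x ≢ y → Σ P (LeastCover x y))
    (least-covers-increase : ∀ {x y m m′} → LeastCover x y m → LeastCover m y m′ → lab x m ≺ lab m m′)
    (other-covers-not-increasing : ∀ {x y m z z′} → LeastCover x y m → x ⋖ₚ z → z ≤ y → z ≢ m →
                                   LeastCover z y z′ → ¬ (lab x z ≺ lab z z′))
    where

    private
      through-other-cover : ∀ {x y m z} → LeastCover x y m → x ⋖ₚ z → z ≢ m → ∀ D → MaxChain z D y →
                            Increasing x (z ∷ D) → ∀ {C} → StartsWithLeastCover z y C → D ≢ C
      through-other-cover {m = m} lc x⋖z z≢m [] refl _ {[]} _ refl =
        proj₂ x⋖z (m , proj₁ cover , (below , λ m≡z → z≢m (sym m≡z)))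
        where open LeastCover lc
      through-other-cover lc x⋖z z≢m (z′ ∷ D) ch (z′-up , _) {.z′ ∷ .D} lc′ refl =
        other-covers-not-increasing lc x⋖z (maxChain⇒≤ (z′ ∷ D) ch) z≢m lc′ z′-up

    -- Any other increasing chain would leave x through a cover z ≠ m, and then
    -- continue along the unique increasing chain above z.
    cons-least-cover : ∀ {x y m} → LeastCover x y m → UniqueIncreasingChain m y →
                       (∀ z → x ⋖ₚ z → z ≤ y → UniqueIncreasingChain z y) → UniqueIncreasingChain x y
    cons-least-cover {x} {y} {m} lc rest above = record
      { chain = m ∷ chain ; maximal = cover , maximal ; increasing = increasing′ chain starts increasing
      ; unique = unique′ ; starts = lc }
      where
      open LeastCover lc
      open UniqueIncreasingChain rest

      increasing′ : ∀ C → StartsWithLeastCover m y C → Increasing m C → Increasing x (m ∷ C)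
      increasing′ [] _ _ = tt
      increasing′ (_ ∷ _) lc′ inc = least-covers-increase lc lc′ , inc

      unique′ : ∀ C → MaxChain x C y → Increasing x C → C ≡ m ∷ chain
      unique′ [] refl _ = ⊥-elim (least-cover⇒≢ lc refl)
      unique′ (z ∷ D) (x⋖z , ch) inc with z ≟ m
      ... | yes refl = cong (z ∷_) (unique D ch (increasing-tail D inc))
      ... | no z≢m = ⊥-elim (through-other-cover lc x⋖z z≢m D ch inc (UniqueIncreasingChain.starts r)
                               (UniqueIncreasingChain.unique r D ch (increasing-tail D inc)))
        where r = above z x⋖z (maxChain⇒≤ D ch)

    greedy-chain : ∀ k {x y} → rank y ℕ.≤ k + rank x → x ≤ y → UniqueIncreasingChain x y
    greedy-chain k {x} {y} fuel x≤y with x ≟ y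
    ... | yes refl = empty-chain x
    ... | no x≢y with least-cover-exists x≤y x≢y
    greedy-chain zero fuel x≤y | no x≢y | _ = ⊥-elim (ℕ.<⇒≱ (rank-mono x≤y x≢y) fuel)
    greedy-chain (suc k) {x} {y} fuel x≤y | no x≢y | m , lc =
      cons-least-cover lc (greedy-chain k (fuel′ cover) below) (λ z x⋖z → greedy-chain k (fuel′ x⋖z))
      where
      open LeastCover lc
      fuel′ : ∀ {z} → x ⋖ₚ z → rank y ℕ.≤ k + rank z
      fuel′ ((x≤z , x≢z) , _) = ℕ.≤-trans fuel
        (ℕ.≤-trans (ℕ.≤-reflexive (sym (ℕ.+-suc k (rank x)))) (ℕ.+-monoʳ-≤ k (rank-mono x≤z x≢z)))

    el-labeling : IsELLabeling _≤_ _≺_ lab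
    el-labeling x y x≤y = chain , maximal , increasing , unique , el2 chain starts
      where
      open UniqueIncreasingChain (greedy-chain (rank y) (ℕ.m≤m+n (rank y) (rank x)) x≤y)
      el2 : ∀ C → StartsWithLeastCover x y C → EL2 _≤_ _≺_ lab x C y
      el2 [] _ = tt
      el2 (_ ∷ _) lc = LeastCover.least lc

least-satisfying : ∀ {m} {Q : Fin m → Set} → (∀ i → Dec (Q i)) → ∃ Q →
             ∃ λ k → Q k × (∀ {j} → j Fin.< k → ¬ Q j)
least-satisfying {suc m} Q? (j , qj) with Q? zero
... | yes q₀ = zero , q₀ , λ ()
least-satisfying {suc m} Q? (zero , qj) | no ¬q₀ = ⊥-elim (¬q₀ qj)
least-satisfying {suc m} Q? (suc j , qj) | no ¬q₀ with least-satisfying (Q? ∘ suc) (j , qj)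
... | k , qk , below = suc k , qk , earlier
  where
  earlier : ∀ {i} → i Fin.< suc k → ¬ _
  earlier {zero} _ = ¬q₀
  earlier {suc i} (s≤s i<k) = below i<k

∣∪∣-disjoint : ∀ {m} (p q : Subset m) → (∀ {c} → c ∈ p → c ∉ q) → ∣ p ∪ q ∣ ≡ ∣ p ∣ + ∣ q ∣
∣∪∣-disjoint [] [] _ = refl
∣∪∣-disjoint (true ∷ p) (true ∷ q) disj = ⊥-elim (disj here here)
∣∪∣-disjoint (true ∷ p) (false ∷ q) disj =
  cong suc (∣∪∣-disjoint p q (λ c∈p c∈q → disj (there c∈p) (there c∈q)))
∣∪∣-disjoint (false ∷ p) (true ∷ q) disj =
  trans (cong suc (∣∪∣-disjoint p q (λ c∈p c∈q → disj (there c∈p) (there c∈q)))) (sym (ℕ.+-suc ∣ p ∣ ∣ q ∣))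
∣∪∣-disjoint (false ∷ p) (false ∷ q) disj = ∣∪∣-disjoint p q (λ c∈p c∈q → disj (there c∈p) (there c∈q))

module Minimum {A K : Set} (_<_ : K → K → Set) (key : A → K) (_≟_ : DecidableEquality A)
  (<-trans : ∀ {u v w} → u < v → v < w → u < w)
  (key-compare : ∀ {u v} → u ≢ v → key u < key v ⊎ key v < key u)
  where

  IsMinimum : (A → Set) → List A → A → Set
  IsMinimum Q xs m = Q m × ∀ {w} → w ∈ᴸ xs → Q w → w ≢ m → key m < key w

  minimum : ∀ {Q : A → Set} → (∀ a → Dec (Q a)) → ∀ xs → (∀ {w} → w ∈ᴸ xs → ¬ Q w) ⊎ ∃ (IsMinimum Q xs)
  minimum Q? [] = inj₁ λ ()
  minimum {Q} Q? (x ∷ xs) with minimum Q? xs | Q? x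
  ... | inj₁ none | no ¬qx = inj₁ λ { (Any.here refl) → ¬qx ; (Any.there w∈) → none w∈ }
  ... | inj₁ none | yes qx = inj₂ (x , qx , λ
    { (Any.here refl) _ x≢x → ⊥-elim (x≢x refl) ; (Any.there w∈) qw _ → ⊥-elim (none w∈ qw) })
  ... | inj₂ (m , qm , least) | no ¬qx = inj₂ (m , qm , λ
    { (Any.here refl) qw _ → ⊥-elim (¬qx qw) ; (Any.there w∈) → least w∈ })
  ... | inj₂ (m , qm , least) | yes qx with x ≟ m
  ...   | yes refl = inj₂ (m , qm , λ
    { (Any.here refl) _ m≢m → ⊥-elim (m≢m refl) ; (Any.there w∈) → least w∈ })
  ...   | no x≢m with key-compare x≢m
  ...     | inj₂ m<x = inj₂ (m , qm , λ { (Any.here refl) _ _ → m<x ; (Any.there w∈) → least w∈ })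
  ...     | inj₁ x<m = inj₂ (x , qx , λ
    { (Any.here refl) _ x≢x → ⊥-elim (x≢x refl) ; (Any.there w∈) → via-m w∈ })
    where
    via-m : ∀ {w} → w ∈ᴸ xs → Q w → w ≢ x → key x < key w
    via-m {w} w∈ qw _ with w ≟ m
    ... | yes refl = x<m
    ... | no w≢m = <-trans x<m (least w∈ qw w≢m)

  minimum-exists : ∀ {Q : A → Set} → (∀ a → Dec (Q a)) → ∀ xs → (∀ w → w ∈ᴸ xs) → ∃ Q →
                   ∃ λ m → Q m × ∀ {w} → Q w → w ≢ m → key m < key w
  minimum-exists Q? xs complete (w , qw) with minimum Q? xs
  ... | inj₁ none = ⊥-elim (none (complete w) qw)
  ... | inj₂ (m , qm , least) = m , qm , λ qw′ → least (complete _) qw′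

first-difference : ∀ {m k} (a b : Fin m → Fin k) → ¬ (∀ i → a i ≡ b i) →
                   ∃ λ i → a i ≢ b i × (∀ {j} → j Fin.< i → a j ≡ b j)
first-difference {m} a b a≢b
  with least-satisfying (λ i → ¬? (a i Fin.≟ b i)) (Fin.¬∀⟶∃¬ m _ (λ i → a i Fin.≟ b i) a≢b)
... | i , ai≢bi , earlier = i , ai≢bi , λ j<i → decidable-stable (a _ Fin.≟ b _) (earlier j<i)

inject₁<suc : ∀ {m} (i : Fin m) → inject₁ i Fin.< suc i
inject₁<suc i = Fin.≤̄⇒inject₁< Fin.≤-refl

inject₁<fromℕ : ∀ {m} (i : Fin m) → inject₁ i Fin.< fromℕ m
inject₁<fromℕ {m} i = subst (toℕ (inject₁ i) ℕ.<_) (sym (Fin.toℕ-fromℕ m)) (Fin.inject₁ℕ< i)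

inject₁-<⁻ : ∀ {m} {a b : Fin m} → inject₁ a Fin.< inject₁ b → a Fin.< b
inject₁-<⁻ {a = a} {b} = subst₂ ℕ._<_ (Fin.toℕ-inject₁ a) (Fin.toℕ-inject₁ b)

inject₁-mono : ∀ {m} {i j : Fin m} → i Fin.< j → inject₁ i Fin.< inject₁ j
inject₁-mono {i = i} {j} = subst₂ ℕ._<_ (sym (Fin.toℕ-inject₁ i)) (sym (Fin.toℕ-inject₁ j))

increasing⇒index≤ : ∀ {m k} (f : Fin m → Fin k) → (∀ {i j} → i Fin.< j → f i Fin.< f j) →
                    ∀ i → toℕ i ℕ.≤ toℕ (f i)
increasing⇒index≤ f inc zero = z≤n
increasing⇒index≤ f inc (suc i) =
  ℕ.≤-<-trans (increasing⇒index≤ (f ∘ inject₁) (inc ∘ inject₁-mono) i) (inc (inject₁<suc i))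

module _ {n : ℕ} where

  _≪_ : Subset n → Subset n → Set
  A ≪ B = ∀ {a b} → a ∈ A → b ∈ B → a Fin.< b

  ≪-trans : ∀ {A B C} → Nonempty B → A ≪ B → B ≪ C → A ≪ C
  ≪-trans (b , b∈B) A≪B B≪C a∈A c∈C = Fin.<-trans (A≪B a∈A b∈B) (B≪C b∈B c∈C)

  adjacent⇒ordered : ∀ {m} (bs : Vec (Subset n) (suc m)) → (∀ i → Nonempty (lookup bs i)) →
                     (∀ i → lookup bs (inject₁ i) ≪ lookup bs (suc i)) →
                     ∀ {i j} → i Fin.< j → lookup bs i ≪ lookup bs j
  adjacent⇒ordered (_ ∷ _) ne adj {zero} {zero} ()
  adjacent⇒ordered (_ ∷ _) ne adj {suc _} {zero} ()
  adjacent⇒ordered (_ ∷ _ ∷ _) ne adj {zero} {suc zero} _ = adj zero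
  adjacent⇒ordered (_ ∷ bs@(_ ∷ _)) ne adj {zero} {suc (suc j)} _ =
    ≪-trans (ne (suc zero)) (adj zero) (adjacent⇒ordered bs (ne ∘ suc) (adj ∘ suc) {zero} {suc j} (s≤s z≤n))
  adjacent⇒ordered (_ ∷ bs@(_ ∷ _)) ne adj {suc i} {suc j} (s≤s i<j) =
    adjacent⇒ordered bs (ne ∘ suc) (adj ∘ suc) i<j

  ordered⇒disjoint : ∀ {m} (bs : Vec (Subset n) m) → (∀ {i j} → i Fin.< j → lookup bs i ≪ lookup bs j) →
                     ∀ {i j a} → a ∈ lookup bs i → a ∈ lookup bs j → i ≡ j
  ordered⇒disjoint bs ord {i} {j} a∈i a∈j with Fin.<-cmp i j
  ... | tri< i<j _ _ = ⊥-elim (Fin.<-irrefl refl (ord i<j a∈i a∈j))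
  ... | tri≈ _ i≡j _ = i≡j
  ... | tri> _ _ j<i = ⊥-elim (Fin.<-irrefl refl (ord j<i a∈j a∈i))

  ∈-⋃⁻ : ∀ {m} (bs : Vec (Subset n) m) {a} → a ∈ ⋃ (toList bs) → ∃ λ i → a ∈ lookup bs i
  ∈-⋃⁻ [] a∈ = ⊥-elim (∉⊥ a∈)
  ∈-⋃⁻ (b ∷ bs) a∈ with x∈p∪q⁻ b (⋃ (toList bs)) a∈
  ... | inj₁ a∈b = zero , a∈b
  ... | inj₂ a∈⋃ = let (i , a∈i) = ∈-⋃⁻ bs a∈⋃ in suc i , a∈i

  ∈-⋃⁺ : ∀ {m} (bs : Vec (Subset n) m) {a} i → a ∈ lookup bs i → a ∈ ⋃ (toList bs)
  ∈-⋃⁺ (b ∷ bs) zero a∈ = x∈p∪q⁺ (inj₁ a∈)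
  ∈-⋃⁺ (b ∷ bs) (suc i) a∈ = x∈p∪q⁺ (inj₂ (∈-⋃⁺ bs i a∈))

  ∣⋃∣-singletons : ∀ {m} (bs : Vec (Subset n) m) → (∀ i → ∣ lookup bs i ∣ ≡ 1) →
                   (∀ {i j a} → a ∈ lookup bs i → a ∈ lookup bs j → i ≡ j) → ∣ ⋃ (toList bs) ∣ ≡ m
  ∣⋃∣-singletons [] _ _ = ∣⊥∣≡0 n
  ∣⋃∣-singletons (b ∷ bs) size disj =
    trans (∣∪∣-disjoint b (⋃ (toList bs)) (λ a∈b a∈⋃ → Fin.0≢1+n (disj a∈b (proj₂ (∈-⋃⁻ bs a∈⋃)))))
          (cong₂ _+_ (size zero)
                 (∣⋃∣-singletons bs (size ∘ suc) (λ a∈i a∈j → Fin.suc-injective (disj a∈i a∈j))))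

-- The parameters n and l of elems in Defs are unused, but appear in its type.
module _ (n l : ℕ) where

  private
    Lex : ∀ {m} → List (Fin m) → List (Fin m) → Set
    Lex = Lex-< _≡_ Fin._<_

  lex-map-suc : ∀ {m} {xs ys : List (Fin m)} → Lex xs ys → Lex (List.map suc xs) (List.map suc ys)
  lex-map-suc (LexCore.base ())
  lex-map-suc halt = halt
  lex-map-suc (this x<y) = this (s≤s x<y)
  lex-map-suc (next refl xs<ys) = next refl (lex-map-suc xs<ys)

  elems-nonempty : ∀ {m} (J : Subset m) {r} → r ∈ J → ∃₂ λ e es → elems n l J ≡ e ∷ es
  elems-nonempty (true ∷ J) _ = zero , _ , refl
  elems-nonempty (false ∷ J) (there r∈J) with elems-nonempty J r∈J
  ... | e , es , eq rewrite eq = suc e , List.map suc es , refl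

  lex-cons : ∀ {m} s {I J : Subset m} → Lex (elems n l I) (elems n l J) →
             Lex (elems n l (s ∷ I)) (elems n l (s ∷ J))
  lex-cons true I<J = next refl (lex-map-suc I<J)
  lex-cons false I<J = lex-map-suc I<J

  heads-agree : ∀ {m} s t {I J : Subset m} →
                (zero ∈ s ∷ I → zero ∈ t ∷ J) → (zero ∈ t ∷ J → zero ∈ s ∷ I) → s ≡ t
  heads-agree true _ to _ with to here
  ... | here = refl
  heads-agree false true _ from with from here
  ... | ()
  heads-agree false false _ _ = refl

  elems-lex : ∀ {m} (I J : Subset m) {p r} →
              (∀ {q} → q Fin.< p → q ∈ I → q ∈ J) → (∀ {q} → q Fin.< p → q ∈ J → q ∈ I) →
              p ∈ I → p ∉ J → p Fin.< r → r ∈ J → Lex (elems n l I) (elems n l J)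
  elems-lex (true ∷ I) (true ∷ J) {zero} _ _ _ p∉J _ _ = ⊥-elim (p∉J here)
  elems-lex (true ∷ I) (false ∷ J) {zero} _ _ _ _ _ (there r∈J) with elems-nonempty J r∈J
  ... | e , es , eq rewrite eq = this (s≤s z≤n)
  elems-lex (s ∷ I) (t ∷ J) {suc p} {suc r} I⊆J J⊆I (there p∈I) p∉J (s≤s p<r) (there r∈J)
    rewrite heads-agree s t (I⊆J (s≤s z≤n)) (J⊆I (s≤s z≤n)) =
    lex-cons t (elems-lex I J (λ q<p q∈I → drop-there (I⊆J (s≤s q<p) (there q∈I)))
                              (λ q<p q∈J → drop-there (J⊆I (s≤s q<p) (there q∈J)))
                              p∈I (p∉J ∘ there) p<r r∈J)

module RHatPoset (n l : ℕ) where

  infix 4 _≤ᴿ_ _≤ᴴ_ _<ᴴ_ _⋖ᴴ_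

  _≤ᴿ_ : R n l → R n l → Set
  _≤ᴿ_ = _≤R_ n l

  _≤ᴴ_ : RHat n l → RHat n l → Set
  _≤ᴴ_ = _≤̂_ n l

  _⋖ᴴ_ : RHat n l → RHat n l → Set
  _⋖ᴴ_ = _⋖_ _≤ᴴ_

  _<ᴴ_ : RHat n l → RHat n l → Set
  _<ᴴ_ = _<ₚ_ _≤ᴴ_

  block : R n l → Fin (suc l) → Subset n
  block x i = lookup (blocks x) i

  block-nonempty : ∀ x i → Nonempty (block x i)
  block-nonempty x@(mkR _ nonempty _) i = recompute (nonempty? (block x i)) (nonempty i)

  blocks-ordered : ∀ x {i j} → i Fin.< j → block x i ≪ block x j
  blocks-ordered x@(mkR _ _ ordered) = adjacent⇒ordered (blocks x) (block-nonempty x) adjacent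
    where
    adjacent : ∀ i → block x (inject₁ i) ≪ block x (suc i)
    adjacent i {a} {b} a∈ b∈ = recompute (a Fin.<? b) (ordered i a b a∈ b∈)

  block-unique : ∀ x {i j a} → a ∈ block x i → a ∈ block x j → i ≡ j
  block-unique x = ordered⇒disjoint (blocks x) (blocks-ordered x)

  blocks-injective : ∀ {x y : R n l} → blocks x ≡ blocks y → x ≡ y
  blocks-injective {mkR _ _ _} {mkR _ _ _} refl = refl

  _≟ᴿ_ : DecidableEquality (R n l)
  x ≟ᴿ y with Vec.≡-dec (Vec.≡-dec Bool._≟_) (blocks x) (blocks y)
  ... | yes eq = yes (blocks-injective eq)
  ... | no neq = no (neq ∘ cong blocks)

  ≤ᴿ-antisym : ∀ {x y} → x ≤ᴿ y → y ≤ᴿ x → x ≡ y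
  ≤ᴿ-antisym {x} {y} x≤y y≤x = blocks-injective (begin
    blocks x                      ≡⟨ Vec.tabulate∘lookup (blocks x) ⟨
    tabulate (block x)            ≡⟨ Vec.tabulate-cong (λ i → ⊆-antisym (x≤y i) (y≤x i)) ⟩
    tabulate (block y)            ≡⟨ Vec.tabulate∘lookup (blocks y) ⟩
    blocks y                      ∎)
    where open Relation.Binary.PropositionalEquality.≡-Reasoning

  new-element : ∀ {x y} → x ≤ᴿ y → x ≢ y → ∃₂ λ i a → a ∈ block y i × a ∉ block x i
  new-element {x} {y} x≤y x≢y
    with Fin.any? (λ i → Fin.any? (λ a → (a ∈? block y i) ×-dec ¬? (a ∈? block x i)))
  ... | yes (i , a , new) = i , a , new
  ... | no none = ⊥-elim (x≢y (≤ᴿ-antisym x≤y y≤x))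
    where
    y≤x : y ≤ᴿ x
    y≤x i {a} a∈y = decidable-stable (a ∈? block x i) (λ a∉x → none (i , a , a∈y , a∉x))

  ≤ᴴ-refl : ∀ {x} → x ≤ᴴ x
  ≤ᴴ-refl {𝟘} = tt
  ≤ᴴ-refl {⟨ x ⟩} = λ i a∈ → a∈
  ≤ᴴ-refl {𝟙} = tt

  ≤ᴴ-trans : ∀ {x y z} → x ≤ᴴ y → y ≤ᴴ z → x ≤ᴴ z
  ≤ᴴ-trans {𝟘} _ _ = tt
  ≤ᴴ-trans {⟨ x ⟩} {⟨ y ⟩} {⟨ z ⟩} x≤y y≤z i = y≤z i ∘ x≤y i
  ≤ᴴ-trans {⟨ x ⟩} {⟨ y ⟩} {𝟙} _ _ = tt
  ≤ᴴ-trans {⟨ x ⟩} {𝟙} {𝟙} _ _ = tt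
  ≤ᴴ-trans {𝟙} {𝟙} {𝟙} _ _ = tt

  ≤ᴴ-antisym : ∀ {x y} → x ≤ᴴ y → y ≤ᴴ x → x ≡ y
  ≤ᴴ-antisym {𝟘} {𝟘} _ _ = refl
  ≤ᴴ-antisym {⟨ x ⟩} {⟨ y ⟩} x≤y y≤x = cong ⟨_⟩ (≤ᴿ-antisym x≤y y≤x)
  ≤ᴴ-antisym {𝟙} {𝟙} _ _ = refl

  ⟨⟩-injective : ∀ {x y : R n l} → ⟨ x ⟩ ≡ ⟨ y ⟩ → x ≡ y
  ⟨⟩-injective refl = refl

  _≟ᴴ_ : DecidableEquality (RHat n l)
  𝟘 ≟ᴴ 𝟘 = yes refl
  ⟨ x ⟩ ≟ᴴ ⟨ y ⟩ with x ≟ᴿ y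
  ... | yes refl = yes refl
  ... | no x≢y = no (x≢y ∘ ⟨⟩-injective)
  𝟙 ≟ᴴ 𝟙 = yes refl
  𝟘 ≟ᴴ ⟨ _ ⟩ = no λ ()
  𝟘 ≟ᴴ 𝟙 = no λ ()
  ⟨ _ ⟩ ≟ᴴ 𝟘 = no λ ()
  ⟨ _ ⟩ ≟ᴴ 𝟙 = no λ ()
  𝟙 ≟ᴴ 𝟘 = no λ ()
  𝟙 ≟ᴴ ⟨ _ ⟩ = no λ ()

  _≤ᴴ?_ : ∀ x y → Dec (x ≤ᴴ y)
  𝟘 ≤ᴴ? _ = yes tt
  ⟨ x ⟩ ≤ᴴ? ⟨ y ⟩ = Fin.all? (λ i → block x i ⊆? block y i)
  ⟨ _ ⟩ ≤ᴴ? 𝟙 = yes tt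
  𝟙 ≤ᴴ? 𝟙 = yes tt
  ⟨ _ ⟩ ≤ᴴ? 𝟘 = no λ ()
  𝟙 ≤ᴴ? 𝟘 = no λ ()
  𝟙 ≤ᴴ? ⟨ _ ⟩ = no λ ()

  support : R n l → Subset n
  support x = ⋃ (toList (blocks x))

  support-strict : ∀ {x y} → x ≤ᴿ y → x ≢ y → support x ⊂ support y
  support-strict {x} {y} x≤y x≢y with new-element x≤y x≢y
  ... | i , a , a∈y , a∉x = grows , a , ∈-⋃⁺ (blocks y) i a∈y , a∉
    where
    grows : support x ⊆ support y
    grows c∈ with ∈-⋃⁻ (blocks x) c∈
    ... | j , c∈x = ∈-⋃⁺ (blocks y) j (x≤y j c∈x)
    a∉ : a ∉ support x
    a∉ a∈ with ∈-⋃⁻ (blocks x) a∈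
    ... | j , a∈x with block-unique y (x≤y j a∈x) a∈y
    ... | refl = a∉x a∈x

  rank : RHat n l → ℕ
  rank 𝟘 = 0
  rank ⟨ x ⟩ = suc ∣ support x ∣
  rank 𝟙 = suc (suc n)

  rank-mono : ∀ {x y} → x ≤ᴴ y → x ≢ y → rank x ℕ.< rank y
  rank-mono {𝟘} {𝟘} _ x≢y = ⊥-elim (x≢y refl)
  rank-mono {𝟘} {⟨ _ ⟩} _ _ = s≤s z≤n
  rank-mono {𝟘} {𝟙} _ _ = s≤s z≤n
  rank-mono {⟨ x ⟩} {⟨ y ⟩} x≤y x≢y = s≤s (p⊂q⇒∣p∣<∣q∣ (support-strict x≤y (x≢y ∘ cong ⟨_⟩)))
  rank-mono {⟨ x ⟩} {𝟙} _ _ = s≤s (s≤s (∣p∣≤n (support x)))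
  rank-mono {𝟙} {𝟙} _ x≢y = ⊥-elim (x≢y refl)

  -- Adding one element to a block

  record Addable (x : R n l) (i : Fin (suc l)) (a : Fin n) : Set where
    field
      fresh : a ∉ block x i
      above-lower : ∀ {j b} → j Fin.< i → b ∈ block x j → b Fin.< a
      below-upper : ∀ {j b} → i Fin.< j → b ∈ block x j → a Fin.< b

  private
    insert : R n l → Fin (suc l) → Fin n → Vec (Subset n) (suc l)
    insert x i a = updateAt (blocks x) i (_∪ ⁅ a ⁆)

    ∈-insert⁻ : ∀ x i a {j c} → c ∈ lookup (insert x i a) j → c ∈ block x j ⊎ (j ≡ i × c ≡ a)
    ∈-insert⁻ x i a {j} {c} c∈ with j Fin.≟ i
    ... | no j≢i = inj₁ (subst (c ∈_) (Vec.lookup∘updateAt′ j i j≢i (blocks x)) c∈)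
    ... | yes refl with x∈p∪q⁻ (block x i) ⁅ a ⁆ (subst (c ∈_) (Vec.lookup∘updateAt i (blocks x)) c∈)
    ...   | inj₁ c∈x = inj₁ c∈x
    ...   | inj₂ c∈a = inj₂ (refl , x∈⁅y⁆⇒x≡y a c∈a)

    ∈-insert⁺ : ∀ x i a {j c} → c ∈ block x j → c ∈ lookup (insert x i a) j
    ∈-insert⁺ x i a {j} {c} c∈ with j Fin.≟ i
    ... | no j≢i = subst (c ∈_) (sym (Vec.lookup∘updateAt′ j i j≢i (blocks x))) c∈
    ... | yes refl = subst (c ∈_) (sym (Vec.lookup∘updateAt i (blocks x))) (x∈p∪q⁺ (inj₁ c∈))

    ∈-insert-new : ∀ x i a → a ∈ lookup (insert x i a) i
    ∈-insert-new x i a = subst (a ∈_) (sym (Vec.lookup∘updateAt i (blocks x))) (x∈p∪q⁺ (inj₂ (x∈⁅x⁆ a)))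

    insert-ordered : ∀ {x i a} → Addable x i a → ∀ {j k b c} → j Fin.< k →
                     b ∈ lookup (insert x i a) j → c ∈ lookup (insert x i a) k → b Fin.< c
    insert-ordered {x} {i} {a} p {j} {k} j<k b∈ c∈ with ∈-insert⁻ x i a b∈ | ∈-insert⁻ x i a c∈
    ... | inj₁ b∈x | inj₁ c∈x = blocks-ordered x j<k b∈x c∈x
    ... | inj₁ b∈x | inj₂ (refl , refl) = Addable.above-lower p j<k b∈x
    ... | inj₂ (refl , refl) | inj₁ c∈x = Addable.below-upper p j<k c∈x
    ... | inj₂ (refl , refl) | inj₂ (refl , refl) = ⊥-elim (Fin.<-irrefl refl j<k)

  add : (x : R n l) (i : Fin (suc l)) (a : Fin n) → .(Addable x i a) → R n l
  add x i a p = mkR (insert x i a)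
    (λ j → proj₁ (block-nonempty x j) , ∈-insert⁺ x i a (proj₂ (block-nonempty x j)))
    (λ j b c b∈ c∈ → insert-ordered p (inject₁<suc j) b∈ c∈)

  ∈-add⁻ : ∀ {x i a} .(p : Addable x i a) {j c} → c ∈ block (add x i a p) j → c ∈ block x j ⊎ (j ≡ i × c ≡ a)
  ∈-add⁻ {x} {i} {a} _ = ∈-insert⁻ x i a

  ∈-add-new : ∀ {x i a} .(p : Addable x i a) → a ∈ block (add x i a p) i
  ∈-add-new {x} {i} {a} _ = ∈-insert-new x i a

  ≤-add : ∀ {x i a} .(p : Addable x i a) → x ≤ᴿ add x i a p
  ≤-add {x} {i} {a} _ j = ∈-insert⁺ x i a

  <-add : ∀ {x i a} (p : Addable x i a) → ⟨ x ⟩ <ᴴ ⟨ add x i a p ⟩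
  <-add {x} {i} {a} p = ≤-add p , λ x≡add →
    Addable.fresh p (subst (λ w → a ∈ block w i) (sym (⟨⟩-injective x≡add)) (∈-add-new p))

  add-least : ∀ {x y i a} .(p : Addable x i a) → x ≤ᴿ y → a ∈ block y i → add x i a p ≤ᴿ y
  add-least p x≤y a∈y j c∈ with ∈-add⁻ p c∈
  ... | inj₁ c∈x = x≤y j c∈x
  ... | inj₂ (refl , refl) = a∈y

  addable-below : ∀ {x y i a} → x ≤ᴿ y → a ∈ block y i → a ∉ block x i → Addable x i a
  addable-below {y = y} x≤y a∈y a∉x = record
    { fresh = a∉x
    ; above-lower = λ j<i b∈x → blocks-ordered y j<i (x≤y _ b∈x) a∈y
    ; below-upper = λ i<j b∈x → blocks-ordered y i<j a∈y (x≤y _ b∈x) }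

  addable-antitone : ∀ {x w i a} → x ≤ᴿ w → Addable w i a → Addable x i a
  addable-antitone x≤w p = record
    { fresh = Addable.fresh p ∘ x≤w _
    ; above-lower = λ j<i b∈x → Addable.above-lower p j<i (x≤w _ b∈x)
    ; below-upper = λ i<j b∈x → Addable.below-upper p i<j (x≤w _ b∈x) }

  add-injective : ∀ {x i a j b} (p : Addable x i a) (q : Addable x j b) →
                  add x j b q ≡ add x i a p → (j , b) ≡ (i , a)
  add-injective {x} {i} {a} {j} {b} p q eq with ∈-add⁻ p (subst (λ w → b ∈ block w j) eq (∈-add-new q))
  ... | inj₁ b∈x = ⊥-elim (Addable.fresh q b∈x)
  ... | inj₂ (refl , refl) = refl

  add-mono : ∀ {x w j b} .(q : Addable x j b) .(q′ : Addable w j b) → x ≤ᴿ w → add x j b q ≤ᴿ add w j b q′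
  add-mono {w = w} q q′ x≤w = add-least {y = add w _ _ q′} q (λ i → ≤-add q′ i ∘ x≤w i) (∈-add-new q′)

  add-covers : ∀ {x i a} (p : Addable x i a) → ⟨ x ⟩ ⋖ᴴ ⟨ add x i a p ⟩
  add-covers {x} {i} {a} p = <-add p , nothing-between
    where
    nothing-between : ¬ Σ (RHat n l) λ w → ⟨ x ⟩ <ᴴ w × w <ᴴ ⟨ add x i a p ⟩
    nothing-between (𝟘 , (() , _) , _)
    nothing-between (𝟙 , _ , (() , _))
    nothing-between (⟨ w ⟩ , (x≤w , x≢w) , (w≤add , w≢add)) with new-element x≤w (x≢w ∘ cong ⟨_⟩)
    ... | j , c , c∈w , c∉x with ∈-add⁻ p (w≤add j c∈w)
    ...   | inj₁ c∈x = c∉x c∈x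
    ...   | inj₂ (refl , refl) = w≢add (cong ⟨_⟩ (≤ᴿ-antisym w≤add (add-least {y = w} p x≤w c∈w)))

  cover-is-add : ∀ {x z} → ⟨ x ⟩ ⋖ᴴ ⟨ z ⟩ → ∃₂ λ i a → Σ (Addable x i a) λ p → z ≡ add x i a p
  cover-is-add {x} {z} ((x≤z , x≢z) , nothing-between) with new-element x≤z (x≢z ∘ cong ⟨_⟩)
  ... | i , a , a∈z , a∉x = i , a , p , z≡add
    where
    p = addable-below {y = z} x≤z a∈z a∉x
    z≡add : z ≡ add x i a p
    z≡add with add x i a p ≟ᴿ z
    ... | yes add≡z = sym add≡z
    ... | no add≢z = ⊥-elim (nothing-between
      (⟨ add x i a p ⟩ , <-add p , add-least {y = z} p x≤z a∈z , add≢z ∘ ⟨⟩-injective))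

  Maximal : R n l → Set
  Maximal x = ∀ i a → ¬ Addable x i a

  maximal⇒⋖𝟙 : ∀ {x} → Maximal x → ⟨ x ⟩ ⋖ᴴ 𝟙
  maximal⇒⋖𝟙 {x} maximal = (tt , λ ()) , nothing-between
    where
    nothing-between : ¬ Σ (RHat n l) λ w → ⟨ x ⟩ <ᴴ w × w <ᴴ 𝟙
    nothing-between (𝟘 , (() , _) , _)
    nothing-between (𝟙 , _ , (_ , 𝟙≢𝟙)) = 𝟙≢𝟙 refl
    nothing-between (⟨ w ⟩ , (x≤w , x≢w) , _) with new-element x≤w (x≢w ∘ cong ⟨_⟩)
    ... | i , a , a∈w , a∉x = maximal i a (addable-below {y = w} x≤w a∈w a∉x)

  ⋖𝟙⇒maximal : ∀ {x} → ⟨ x ⟩ ⋖ᴴ 𝟙 → Maximal x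
  ⋖𝟙⇒maximal (_ , nothing-between) i a p = nothing-between (⟨ add _ i a p ⟩ , <-add p , tt , λ ())

  addable? : ∀ x i a → Dec (Addable x i a)
  addable? x i a = map′
    (λ (fresh , lower , upper) → record { fresh = fresh ; above-lower = lower _ _ ; below-upper = upper _ _ })
    (λ p → Addable.fresh p , (λ _ _ → Addable.above-lower p) , (λ _ _ → Addable.below-upper p))
    (¬? (a ∈? block x i)
      ×-dec Fin.all? (λ j → Fin.all? λ b → (j Fin.<? i) →-dec (b ∈? block x j) →-dec (b Fin.<? a))
      ×-dec Fin.all? (λ j → Fin.all? λ b → (i Fin.<? j) →-dec (b ∈? block x j) →-dec (a Fin.<? b)))

  StrictlyIncreasing : (Fin (suc l) → Fin n) → Set
  StrictlyIncreasing a = ∀ {i j} → i Fin.< j → a i Fin.< a j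

  atom-blocks : (Fin (suc l) → Fin n) → Vec (Subset n) (suc l)
  atom-blocks a = tabulate (⁅_⁆ ∘ a)

  ∈-atom⁻ : ∀ a {i c} → c ∈ lookup (atom-blocks a) i → c ≡ a i
  ∈-atom⁻ a {i} {c} c∈ = x∈⁅y⁆⇒x≡y (a i) (subst (c ∈_) (Vec.lookup∘tabulate (⁅_⁆ ∘ a) i) c∈)

  ∈-atom⁺ : ∀ a i → a i ∈ lookup (atom-blocks a) i
  ∈-atom⁺ a i = subst (a i ∈_) (sym (Vec.lookup∘tabulate (⁅_⁆ ∘ a) i)) (x∈⁅x⁆ (a i))

  atom : (a : Fin (suc l) → Fin n) → .(StrictlyIncreasing a) → R n l
  atom a inc = mkR (atom-blocks a) (λ i → a i , ∈-atom⁺ a i)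
    (λ i b c b∈ c∈ → subst₂ Fin._<_ (sym (∈-atom⁻ a b∈)) (sym (∈-atom⁻ a c∈)) (inc {inject₁ i} (inject₁<suc i)))

  atom-⋖𝟘 : ∀ a .(inc : StrictlyIncreasing a) → 𝟘 ⋖ᴴ ⟨ atom a inc ⟩
  atom-⋖𝟘 a inc = (tt , λ ()) , nothing-between
    where
    nothing-between : ¬ Σ (RHat n l) λ w → 𝟘 <ᴴ w × w <ᴴ ⟨ atom a inc ⟩
    nothing-between (𝟘 , (_ , 𝟘≢𝟘) , _) = 𝟘≢𝟘 refl
    nothing-between (𝟙 , _ , (() , _))
    nothing-between (⟨ w ⟩ , _ , (w≤atom , w≢atom)) = w≢atom (cong ⟨_⟩ (≤ᴿ-antisym w≤atom atom≤w))
      where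
      atom≤w : atom a inc ≤ᴿ w
      atom≤w i c∈ with block-nonempty w i
      ... | b , b∈w = subst (_∈ block w i) (trans (∈-atom⁻ a {i} (w≤atom i b∈w)) (sym (∈-atom⁻ a {i} c∈))) b∈w

  pick : R n l → Fin (suc l) → Fin n
  pick z i = proj₁ (block-nonempty z i)

  pick-increasing : ∀ z → StrictlyIncreasing (pick z)
  pick-increasing z i<j = blocks-ordered z i<j (proj₂ (block-nonempty z _)) (proj₂ (block-nonempty z _))

  -- The atom of chosen elements of z lies below z, so if z covers 𝟘 it is that atom.
  𝟘⋖⇒atom : ∀ {z} → 𝟘 ⋖ᴴ ⟨ z ⟩ → ∃₂ λ b (inc : StrictlyIncreasing b) → z ≡ atom b inc
  𝟘⋖⇒atom {z} (_ , nothing-between) with atom (pick z) (pick-increasing z) ≟ᴿ z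
  ... | yes atom≡z = pick z , pick-increasing z , sym atom≡z
  ... | no atom≢z =
    ⊥-elim (nothing-between
      (⟨ atom (pick z) (pick-increasing z) ⟩ , (tt , λ ()) , atom≤z , atom≢z ∘ ⟨⟩-injective))
    where
    atom≤z : atom (pick z) (pick-increasing z) ≤ᴿ z
    atom≤z i c∈ = subst (_∈ block z i) (sym (∈-atom⁻ (pick z) {i} c∈)) (proj₂ (block-nonempty z i))

  atom-cong : ∀ {a b} .(inc-a : StrictlyIncreasing a) .(inc-b : StrictlyIncreasing b) →
              (∀ i → a i ≡ b i) → atom a inc-a ≡ atom b inc-b
  atom-cong _ _ a≗b = blocks-injective (Vec.tabulate-cong (cong ⁅_⁆ ∘ a≗b))

  increasing-reflects : ∀ {a} → StrictlyIncreasing a → ∀ {i j} → a i Fin.< a j → i Fin.< j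
  increasing-reflects inc {i} {j} ai<aj with Fin.<-cmp i j
  ... | tri< i<j _ _ = i<j
  ... | tri≈ _ refl _ = ⊥-elim (Fin.<-irrefl refl ai<aj)
  ... | tri> _ _ j<i = ⊥-elim (Fin.<-asym ai<aj (inc j<i))

  Label : Set
  Label = Λ n l

  infix 4 _≺ᴸ_
  _≺ᴸ_ : Label → Label → Set
  _≺ᴸ_ = _≺_ n l

  private
    module α-order = IsStrictTotalOrder
      (×-isStrictTotalOrder (Fin.<-isStrictTotalOrder {suc l}) (Fin.<-isStrictTotalOrder {suc n}))
    module β-order = IsStrictTotalOrder
      (×-isStrictTotalOrder (Flip.isStrictTotalOrder (Fin.<-isStrictTotalOrder {suc l}))
                            (Fin.<-isStrictTotalOrder {suc n}))
    module ι-order = IsStrictTotalOrder (ListLex.<-isStrictTotalOrder (Fin.<-isStrictTotalOrder {n}))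

  ≺-trans : ∀ {u v w} → u ≺ᴸ v → v ≺ᴸ w → u ≺ᴸ w
  ≺-trans {α _ _} {α _ _} {α _ _} u≺v v≺w = α-order.trans u≺v v≺w
  ≺-trans {ι _ _} {ι _ _} {ι _ _} u≺v v≺w = ι-order.trans u≺v v≺w
  ≺-trans {β _ _} {β _ _} {β _ _} u≺v v≺w = β-order.trans u≺v v≺w
  ≺-trans {α _ _} {_} {ι _ _} _ _ = tt
  ≺-trans {α _ _} {_} {β _ _} _ _ = tt
  ≺-trans {ι _ _} {_} {β _ _} _ _ = tt
  ≺-trans {α _ _} {ι _ _} {α _ _} _ ()
  ≺-trans {α _ _} {β _ _} {α _ _} _ ()
  ≺-trans {ι _ _} {ι _ _} {α _ _} _ ()
  ≺-trans {ι _ _} {β _ _} {α _ _} _ ()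
  ≺-trans {ι _ _} {β _ _} {ι _ _} _ ()
  ≺-trans {β _ _} {β _ _} {α _ _} _ ()
  ≺-trans {β _ _} {β _ _} {ι _ _} _ ()
  ≺-trans {ι _ _} {α _ _} () _
  ≺-trans {β _ _} {α _ _} () _
  ≺-trans {β _ _} {ι _ _} () _

  ≺-asym : ∀ {u v} → u ≺ᴸ v → ¬ v ≺ᴸ u
  ≺-asym {α _ _} {α _ _} = α-order.asym
  ≺-asym {ι _ _} {ι _ _} = ι-order.asym
  ≺-asym {β _ _} {β _ _} = β-order.asym
  ≺-asym {α _ _} {ι _ _} _ ()
  ≺-asym {α _ _} {β _ _} _ ()
  ≺-asym {ι _ _} {β _ _} _ ()
  ≺-asym {ι _ _} {α _ _} ()
  ≺-asym {β _ _} {α _ _} ()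
  ≺-asym {β _ _} {ι _ _} ()

  IsAlpha : Label → Set
  IsAlpha (α _ _) = ⊤
  IsAlpha (ι _ _) = ⊥
  IsAlpha (β _ _) = ⊥

  infix 4 _≼ᴸ_
  _≼ᴸ_ : Label → Label → Set
  _≼ᴸ_ = StrictToNonStrict._≤_ _≡_ _≺ᴸ_

  ≼-trans : ∀ {u v w} → u ≼ᴸ v → v ≼ᴸ w → u ≼ᴸ w
  ≼-trans = StrictToNonStrict.trans _≡_ _≺ᴸ_ isEquivalence (resp₂ _≺ᴸ_) ≺-trans

  ≺-≼-trans : ∀ {u v w} → u ≺ᴸ v → v ≼ᴸ w → u ≺ᴸ w
  ≺-≼-trans = StrictToNonStrict.<-≤-trans _≡_ _≺ᴸ_ ≺-trans (proj₁ (resp₂ _≺ᴸ_))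

  ≼α⇒IsAlpha : ∀ {u i a} → u ≼ᴸ α i a → IsAlpha u
  ≼α⇒IsAlpha {α _ _} _ = tt
  ≼α⇒IsAlpha {ι _ _} (inj₁ ())
  ≼α⇒IsAlpha {β _ _} (inj₁ ())

  IsAlpha⇒ι⊀ : ∀ {u I} .{∣I∣} → IsAlpha u → ¬ ι I ∣I∣ ≺ᴸ u
  IsAlpha⇒ι⊀ {α _ _} _ ()

  BelowMax : R n l → Fin (suc l) → Fin n → Set
  BelowMax x i a = ∃ λ b → b ∈ block x i × a Fin.< b

  belowMax? : ∀ x i a → Dec (BelowMax x i a)
  belowMax? x i a = Fin.any? (λ b → (b ∈? block x i) ×-dec (a Fin.<? b))

  addLabel : R n l → Fin (suc l) → Fin n → Label
  addLabel x i a = if belowMax n l a (block x i) then α i (inject₁ a) else β i (inject₁ a)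

  addLabel-α : ∀ {x i a} → BelowMax x i a → addLabel x i a ≡ α i (inject₁ a)
  addLabel-α {x} {i} {a} below = cong (if_then α i (inject₁ a) else β i (inject₁ a))
    (trans (isYes≗does (belowMax? x i a)) (dec-true (belowMax? x i a) below))

  addLabel-β : ∀ {x i a} → ¬ BelowMax x i a → addLabel x i a ≡ β i (inject₁ a)
  addLabel-β {x} {i} {a} ¬below = cong (if_then α i (inject₁ a) else β i (inject₁ a))
    (trans (isYes≗does (belowMax? x i a)) (dec-false (belowMax? x i a) ¬below))

  private
    old-head : ∀ {m} s t {A B : Subset m} → (zero ∈ t ∷ B → zero ∈ s ∷ A) → not s ∧ t ≡ false
    old-head true _ _ = refl
    old-head false false _ = refl
    old-head false true old with old here
    ... | ()

  firstNew-⊆ : ∀ {m} (A B : Subset m) → B ⊆ A → firstNew n l A B ≡ nothing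
  firstNew-⊆ [] [] _ = refl
  firstNew-⊆ (s ∷ A) (t ∷ B) B⊆A
    rewrite old-head s t B⊆A | firstNew-⊆ A B (drop-there ∘ B⊆A ∘ there) = refl

  firstNew-least : ∀ {m} (A B : Subset m) {c} → c ∉ A → c ∈ B → (∀ {d} → d Fin.< c → d ∈ B → d ∈ A) →
                   firstNew n l A B ≡ just c
  firstNew-least (true ∷ A) (_ ∷ B) {zero} c∉A _ _ = ⊥-elim (c∉A here)
  firstNew-least (false ∷ A) (_ ∷ B) {zero} _ here _ = refl
  firstNew-least (s ∷ A) (t ∷ B) {suc c} c∉A (there c∈B) earlier
    rewrite old-head s t (earlier (s≤s z≤n))
          | firstNew-least A B (c∉A ∘ there) c∈B (λ d<c d∈B → drop-there (earlier (s≤s d<c) (there d∈B))) = refl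

  newIn-first : ∀ {k} (As Bs : Vec (Subset n) k) {i a} → (∀ {j} → j Fin.< i → lookup Bs j ⊆ lookup As j) →
                firstNew n l (lookup As i) (lookup Bs i) ≡ just a → newIn n l As Bs ≡ just (i , a)
  newIn-first (A ∷ As) (B ∷ Bs) {zero} _ first rewrite first = refl
  newIn-first (A ∷ As) (B ∷ Bs) {suc i} earlier first
    rewrite firstNew-⊆ A B (earlier (s≤s z≤n)) | newIn-first As Bs (earlier ∘ s≤s) first = refl

  add-unchanged-before : ∀ {x i a} .(p : Addable x i a) {j} → j Fin.< i → block (add x i a p) j ⊆ block x j
  add-unchanged-before p j<i c∈ with ∈-add⁻ p c∈
  ... | inj₁ c∈x = c∈x
  ... | inj₂ (refl , _) = ⊥-elim (Fin.<-irrefl refl j<i)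

  add-unchanged-below : ∀ {x i a} .(p : Addable x i a) {d} → d Fin.< a →
                        d ∈ block (add x i a p) i → d ∈ block x i
  add-unchanged-below p d<a d∈ with ∈-add⁻ p d∈
  ... | inj₁ d∈x = d∈x
  ... | inj₂ (_ , refl) = ⊥-elim (Fin.<-irrefl refl d<a)

  lab-add : ∀ {x i a} (p : Addable x i a) → lab n l ⟨ x ⟩ ⟨ add x i a p ⟩ ≡ addLabel x i a
  lab-add {x} {i} {a} p
    rewrite newIn-first (blocks x) (blocks (add x i a p)) (add-unchanged-before p)
              (firstNew-least (block x i) (block (add x i a p) i) (Addable.fresh p) (∈-add-new p)
                              (add-unchanged-below p)) = refl

  belowMax-mono : ∀ {x w i a} → x ≤ᴿ w → BelowMax x i a → BelowMax w i a
  belowMax-mono x≤w (b , b∈x , a<b) = b , x≤w _ b∈x , a<b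

  belowMax-add⁻ : ∀ {x i a} .(p : Addable x i a) {j b} → BelowMax (add x i a p) j b →
                  BelowMax x j b ⊎ (j ≡ i × b Fin.< a)
  belowMax-add⁻ p (d , d∈ , b<d) with ∈-add⁻ p d∈
  ... | inj₁ d∈x = inj₁ (d , d∈x , b<d)
  ... | inj₂ (refl , refl) = inj₂ (refl , b<d)

  addLabel-antitone : ∀ {x z} → x ≤ᴿ z → ∀ i a → addLabel z i a ≼ᴸ addLabel x i a
  addLabel-antitone {x} {z} x≤z i a with belowMax? x i a | belowMax? z i a
  ... | yes _ | yes _ = inj₂ refl
  ... | yes below | no ¬below = ⊥-elim (¬below (belowMax-mono {x} {z} x≤z below))
  ... | no _ | yes _ = inj₁ tt
  ... | no _ | no _ = inj₂ refl

  ∣support-atom∣ : ∀ a .(inc : StrictlyIncreasing a) → ∣ support (atom a inc) ∣ ≡ suc l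
  ∣support-atom∣ a inc = ∣⋃∣-singletons (atom-blocks a)
    (λ i → trans (cong ∣_∣ (Vec.lookup∘tabulate (⁅_⁆ ∘ a) i)) (∣⁅x⁆∣≡1 (a i))) (block-unique (atom a inc))

  lab-atom : ∀ a .(inc : StrictlyIncreasing a) →
             lab n l 𝟘 ⟨ atom a inc ⟩ ≡ ι (support (atom a inc)) (∣support-atom∣ a inc)
  lab-atom a inc with ∣ support (atom a inc) ∣ ℕ.≟ suc l
  ... | yes _ = refl
  ... | no ∣support∣≢ = ⊥-elim (∣support∣≢ (∣support-atom∣ a inc))

  -- Where a and b first differ, a k ∈ support a is missing from support b, which has the larger b k.
  atom-label-≺ : ∀ {a b} (inc-a : StrictlyIncreasing a) (inc-b : StrictlyIncreasing b) → (∀ i → a i Fin.≤ b i) →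
                 ∀ {k} → a k ≢ b k → (∀ {i} → i Fin.< k → a i ≡ b i) →
                 lab n l 𝟘 ⟨ atom a inc-a ⟩ ≺ᴸ lab n l 𝟘 ⟨ atom b inc-b ⟩
  atom-label-≺ {a} {b} inc-a inc-b a≤b {k} ak≢bk agree =
    subst₂ _≺ᴸ_ (sym (lab-atom a inc-a)) (sym (lab-atom b inc-b))
      (elems-lex n l (support (atom a inc-a)) (support (atom b inc-b)) a→b b→a
        (∈-⋃⁺ (atom-blocks a) k (∈-atom⁺ a k)) ak∉b ak<bk (∈-⋃⁺ (atom-blocks b) k (∈-atom⁺ b k)))
    where
    ak<bk : a k Fin.< b k
    ak<bk = Fin.≤∧≢⇒< (a≤b k) ak≢bk
    a→b : ∀ {q} → q Fin.< a k → q ∈ support (atom a inc-a) → q ∈ support (atom b inc-b)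
    a→b q<ak q∈ with ∈-⋃⁻ (atom-blocks a) q∈
    ... | i , q∈i with ∈-atom⁻ a {i} q∈i
    ...   | refl = ∈-⋃⁺ (atom-blocks b) i
                     (subst (_∈ lookup (atom-blocks b) i) (sym (agree (increasing-reflects inc-a q<ak)))
                            (∈-atom⁺ b i))
    b→a : ∀ {q} → q Fin.< a k → q ∈ support (atom b inc-b) → q ∈ support (atom a inc-a)
    b→a q<ak q∈ with ∈-⋃⁻ (atom-blocks b) q∈
    ... | i , q∈i with ∈-atom⁻ b {i} q∈i
    ...   | refl = ∈-⋃⁺ (atom-blocks a) i
                     (subst (_∈ lookup (atom-blocks a) i)
                            (agree (increasing-reflects inc-b (ℕ.<-≤-trans q<ak (a≤b k))))
                            (∈-atom⁺ a i))
    ak∉b : a k ∉ support (atom b inc-b)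
    ak∉b ak∈ with ∈-⋃⁻ (atom-blocks b) ak∈
    ... | j , ak∈j with ∈-atom⁻ b {j} ak∈j | Fin.<-cmp j k
    ...   | ak≡bj | tri< j<k _ _ = Fin.<-irrefl (sym (trans ak≡bj (sym (agree j<k)))) (inc-a j<k)
    ...   | ak≡bj | tri≈ _ refl _ = ak≢bk ak≡bj
    ...   | ak≡bj | tri> _ _ k<j = Fin.<-irrefl ak≡bj (Fin.<-trans ak<bk (inc-b k<j))

  open LeastCoverCriterion _≤ᴴ_ _≺ᴸ_ (lab n l) ≤ᴴ-refl ≤ᴴ-trans ≤ᴴ-antisym _≟ᴴ_ rank rank-mono public

  -- Least covers above an element

  AddableWithin : R n l → RHat n l → Fin (suc l) × Fin n → Set
  AddableWithin x y (i , a) = Σ (Addable x i a) λ p → ⟨ add x i a p ⟩ ≤ᴴ y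

  addableWithin? : ∀ x y ia → Dec (AddableWithin x y ia)
  addableWithin? x y (i , a) with addable? x i a
  ... | no ¬p = no (¬p ∘ proj₁)
  ... | yes p with ⟨ add x i a p ⟩ ≤ᴴ? y
  ...   | yes add≤y = yes (p , add≤y)
  ...   | no add≰y = no (add≰y ∘ proj₂)

  LeastAddition : R n l → RHat n l → Fin (suc l) × Fin n → Set
  LeastAddition x y (i , a) =
    ∀ {j b} → AddableWithin x y (j , b) → (j , b) ≢ (i , a) → addLabel x i a ≺ᴸ addLabel x j b

  addLabel-compare : ∀ x {u v} → u ≢ v →
                     uncurry (addLabel x) u ≺ᴸ uncurry (addLabel x) v ⊎
                     uncurry (addLabel x) v ≺ᴸ uncurry (addLabel x) u
  addLabel-compare x {i , a} {j , b} ia≢jb with belowMax? x i a | belowMax? x j b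
  ... | yes _ | no _ = inj₁ tt
  ... | no _ | yes _ = inj₂ tt
  ... | yes _ | yes _ with α-order.compare (i , inject₁ a) (j , inject₁ b)
  ...   | tri< lt _ _ = inj₁ lt
  ...   | tri≈ _ (refl , eq) _ = ⊥-elim (ia≢jb (cong (i ,_) (Fin.inject₁-injective eq)))
  ...   | tri> _ _ gt = inj₂ gt
  addLabel-compare x {i , a} {j , b} ia≢jb | no _ | no _
    with β-order.compare (i , inject₁ a) (j , inject₁ b)
  ... | tri< lt _ _ = inj₁ lt
  ... | tri≈ _ (refl , eq) _ = ⊥-elim (ia≢jb (cong (i ,_) (Fin.inject₁-injective eq)))
  ... | tri> _ _ gt = inj₂ gt

  private
    pairs : List.List (Fin (suc l) × Fin n)
    pairs = List.cartesianProduct (List.allFin (suc l)) (List.allFin n)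

    complete : ∀ ia → ia ∈ᴸ pairs
    complete (i , a) = ∈-cartesianProduct⁺ (∈-allFin i) (∈-allFin a)

  least-addition-exists : ∀ x y → ∃ (AddableWithin x y) → ∃ λ ia → AddableWithin x y ia × LeastAddition x y ia
  least-addition-exists x y within
    with Minimum.minimum-exists _≺ᴸ_ (uncurry (addLabel x)) (Product.≡-dec Fin._≟_ Fin._≟_) ≺-trans
           (addLabel-compare x) (addableWithin? x y) pairs complete within
  ... | ia , within-ia , least = ia , within-ia , λ {j} {b} → least {j , b}


  least-addition⇒least-cover : ∀ {x y i a} ((p , _) : AddableWithin x y (i , a)) → LeastAddition x y (i , a) →
                               LeastCover ⟨ x ⟩ y ⟨ add x i a p ⟩
  least-addition⇒least-cover {x} {y} {i} {a} (p , add≤y) least =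
    record { cover = add-covers p ; below = add≤y ; least = least-cover }
    where
    least-cover : ∀ z → ⟨ x ⟩ ⋖ᴴ z → z ≤ᴴ y → z ≢ ⟨ add x i a p ⟩ →
                  lab n l ⟨ x ⟩ ⟨ add x i a p ⟩ ≺ᴸ lab n l ⟨ x ⟩ z
    least-cover 𝟘 ((() , _) , _)
    least-cover 𝟙 x⋖𝟙 _ _ = ⊥-elim (⋖𝟙⇒maximal x⋖𝟙 i a p)
    least-cover ⟨ z ⟩ x⋖z z≤y z≢add with cover-is-add x⋖z
    ... | j , b , q , refl =
      subst₂ _≺ᴸ_ (sym (lab-add p)) (sym (lab-add q)) (least (q , z≤y) λ { refl → z≢add refl })

  least-cover⇒least-addition : ∀ {x y i a} (p : Addable x i a) → LeastCover ⟨ x ⟩ y ⟨ add x i a p ⟩ →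
                               LeastAddition x y (i , a)
  least-cover⇒least-addition p lc (q , add≤y) jb≢ia =
    subst₂ _≺ᴸ_ (lab-add p) (lab-add q)
      (LeastCover.least lc _ (add-covers q) add≤y (jb≢ia ∘ add-injective p q ∘ ⟨⟩-injective))

  -- Below y = ⟨ y′ ⟩ some new element of y′ always fits; below 𝟙 nothing fits only if x is maximal.
  least-cover-above : ∀ {x y} → ⟨ x ⟩ ≤ᴴ y → ⟨ x ⟩ ≢ y → Σ (RHat n l) (LeastCover ⟨ x ⟩ y)
  least-cover-above {x} {y} x≤y x≢y with Fin.any? (λ i → Fin.any? (λ a → addableWithin? x y (i , a)))
  ... | yes (i , a , within) with least-addition-exists x y ((i , a) , within)
  ...   | (j , b) , (q , add≤y) , least = ⟨ add x j b q ⟩ , least-addition⇒least-cover (q , add≤y) least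
  least-cover-above {x} {⟨ y ⟩} x≤y x≢y | no nothing-fits with new-element x≤y (x≢y ∘ cong ⟨_⟩)
  ... | i , a , a∈y , a∉x = ⊥-elim (nothing-fits (i , a , p , add-least {y = y} p x≤y a∈y))
    where p = addable-below {y = y} x≤y a∈y a∉x
  least-cover-above {x} {𝟙} _ _ | no nothing-fits =
    𝟙 , record { cover = maximal⇒⋖𝟙 maximal ; below = tt ; least = least }
    where
    maximal : Maximal x
    maximal i a p = nothing-fits (i , a , p , tt)
    least : ∀ z → ⟨ x ⟩ ⋖ᴴ z → z ≤ᴴ 𝟙 → z ≢ 𝟙 → lab n l ⟨ x ⟩ 𝟙 ≺ᴸ lab n l ⟨ x ⟩ z
    least 𝟘 ((() , _) , _)
    least 𝟙 _ _ 𝟙≢𝟙 = ⊥-elim (𝟙≢𝟙 refl)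
    least ⟨ z ⟩ x⋖z _ _ with cover-is-add x⋖z
    ... | i , a , p , _ = ⊥-elim (maximal i a p)

  least-label-α-shaped : ∀ {z y z′ k c} → LeastCover ⟨ z ⟩ y z′ → AddableWithin z y (k , c) → BelowMax z k c →
                         IsAlpha (lab n l ⟨ z ⟩ z′)
  least-label-α-shaped {z} {z′ = z′} lc (r , add≤y) below =
    ≼α⇒IsAlpha (subst (lab n l ⟨ z ⟩ z′ ≼ᴸ_) (trans (lab-add r) (addLabel-α {z} below))
                      (least-label-≼ lc (add-covers r) add≤y))

  within-before-add : ∀ {x i a} (p : Addable x i a) {y jb} →
                      AddableWithin (add x i a p) y jb → AddableWithin x y jb
  within-before-add {x} {i} {a} p {y} {j , b} (q , add≤y) =
    q′ , ≤ᴴ-trans {⟨ add x j b q′ ⟩} {⟨ add (add x i a p) j b q ⟩} {y} (add-mono q′ q (≤-add p)) add≤y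
    where q′ = addable-antitone {w = add x i a p} (≤-add p) q

  -- a is above block i but not below its maximum, so it also fits (below everything) into block i + 1.
  addable-next-block : ∀ {x} (i : Fin l) {a} → Addable x (inject₁ i) a → ¬ BelowMax x (inject₁ i) a →
                       Addable x (suc i) a × BelowMax x (suc i) a
  addable-next-block {x} i {a} p ¬below =
    record { fresh = λ a∈ → Fin.<-irrefl refl (below-next a∈)
           ; above-lower = above-lower ; below-upper = below-upper }
    , c , c∈ , below-next c∈
    where
    c = proj₁ (block-nonempty x (suc i))
    c∈ = proj₂ (block-nonempty x (suc i))
    below-next : ∀ {b} → b ∈ block x (suc i) → a Fin.< b
    below-next = Addable.below-upper p (inject₁<suc i)
    above-lower : ∀ {j b} → j Fin.< suc i → b ∈ block x j → b Fin.< a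
    above-lower {j} {b} j<si b∈ with Fin.<-cmp j (inject₁ i)
    ... | tri< j<i _ _ = Addable.above-lower p j<i b∈
    ... | tri> _ _ i<j = ⊥-elim (ℕ.<⇒≱ (subst (ℕ._< toℕ j) (Fin.toℕ-inject₁ i) i<j) (ℕ.≤-pred j<si))
    ... | tri≈ _ refl _ with Fin.<-cmp b a
    ...   | tri< b<a _ _ = b<a
    ...   | tri≈ _ refl _ = ⊥-elim (Addable.fresh p b∈)
    ...   | tri> _ _ a<b = ⊥-elim (¬below (b , b∈ , a<b))
    below-upper : ∀ {j b} → suc i Fin.< j → b ∈ block x j → a Fin.< b
    below-upper si<j = Addable.below-upper p (Fin.<-trans (inject₁<suc i) si<j)

  least-β-in-last-block : ∀ {x i a} → Addable x i a → LeastAddition x 𝟙 (i , a) → ¬ BelowMax x i a → i ≡ fromℕ l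
  least-β-in-last-block {x} {i} {a} p least ¬below with view i
  ... | ‵fromℕ = refl
  ... | ‵inject₁ i′ with addable-next-block i′ p ¬below
  ...   | p′ , below′ = ⊥-elim (subst₂ _≺ᴸ_ (addLabel-β {x} ¬below) (addLabel-α {x} below′)
                                  (least (p′ , tt) λ e → Fin.<-irrefl (cong proj₁ (sym e)) (inject₁<suc i′)))

  least-addition-below-top : ∀ {x i a} → Addable x i a → LeastAddition x 𝟙 (i , a) →
                             addLabel x i a ≺ᴸ β (fromℕ l) (fromℕ n)
  least-addition-below-top {x} {i} {a} p least with belowMax? x i a | least-β-in-last-block p least
  ... | yes _ | _ = tt
  ... | no ¬below | in-last-block with in-last-block ¬below
  ...   | refl = inj₂ (refl , inject₁<fromℕ a)

  -- An α-label after the least one was already an α-label for x, and after a least β-label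
  -- no α-label is left.
  least-then-next-increasing : ∀ {x y i a} (p : Addable x i a) → LeastAddition x y (i , a) →
                               ∀ {j b} → AddableWithin x y (j , b) → (q : Addable (add x i a p) j b) →
                               addLabel x i a ≺ᴸ addLabel (add x i a p) j b
  least-then-next-increasing {x} {y} {i} {a} p least {j} {b} within q
    with belowMax? x i a | belowMax? (add x i a p) j b
       | least within (λ { refl → Addable.fresh q (∈-add-new p) })
  ... | yes _ | no _ | _ = tt
  ... | yes (e , e∈x , a<e) | yes below | ia≺jb = subst (α i (inject₁ a) ≺ᴸ_) (addLabel-α {x} xb) ia≺jb
    where
    xb : BelowMax x j b
    xb with belowMax-add⁻ p below
    ... | inj₁ xb = xb
    ... | inj₂ (refl , b<a) = e , e∈x , Fin.<-trans b<a a<e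
  ... | no _ | no _ | ia≺jb = subst (β i (inject₁ a) ≺ᴸ_) (addLabel-β {x} ¬xb) ia≺jb
    where
    ¬xb : ¬ BelowMax x j b
    ¬xb xb = subst (β i (inject₁ a) ≺ᴸ_) (addLabel-α {x} xb) ia≺jb
  ... | no _ | yes below | ia≺jb with belowMax-add⁻ p below
  ...   | inj₁ xb = subst (β i (inject₁ a) ≺ᴸ_) (addLabel-α {x} xb) ia≺jb
  ...   | inj₂ (refl , b<a) with belowMax? x i b
  ...     | yes _ = ia≺jb
  ...     | no _ with ia≺jb
  ...       | inj₁ i<i = Fin.<-irrefl refl i<i
  ...       | inj₂ (_ , a<b) = Fin.<-asym b<a (inject₁-<⁻ a<b)

  least-addition-then-increasing : ∀ {x y i a} ((p , _) : AddableWithin x y (i , a)) →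
                                   LeastAddition x y (i , a) → ∀ {m′} → LeastCover ⟨ add x i a p ⟩ y m′ →
                                   addLabel x i a ≺ᴸ lab n l ⟨ add x i a p ⟩ m′
  least-addition-then-increasing _ _ {𝟘} lc′ = ⊥-elim (proj₁ (proj₁ (LeastCover.cover lc′)))
  least-addition-then-increasing {y = 𝟙} (p , _) least {𝟙} _ = least-addition-below-top p least
  least-addition-then-increasing {y = 𝟘} _ _ {𝟙} lc′ = ⊥-elim (LeastCover.below lc′)
  least-addition-then-increasing {y = ⟨ _ ⟩} _ _ {𝟙} lc′ = ⊥-elim (LeastCover.below lc′)
  least-addition-then-increasing {x} (p , _) least {⟨ w ⟩} lc′ with cover-is-add (LeastCover.cover lc′)
  ... | j , b , q , refl = subst (addLabel x _ _ ≺ᴸ_) (sym (lab-add q))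
    (least-then-next-increasing p least (within-before-add p (q , LeastCover.below lc′)) q)

  still-addable : ∀ {x i a j b} (p : Addable x i a) (q : Addable x j b) → LeastAddition x 𝟙 (i , a) →
                  (j , b) ≢ (i , a) → ¬ j Fin.< i → Addable (add x j b q) i a
  still-addable {x} {i} {a} {j} {b} p q least jb≢ia j≮i =
    record { fresh = fresh ; above-lower = above-lower ; below-upper = below-upper }
    where
    fresh : a ∉ block (add x j b q) i
    fresh a∈ with ∈-add⁻ q a∈
    ... | inj₁ a∈x = Addable.fresh p a∈x
    ... | inj₂ (refl , refl) = jb≢ia refl
    above-lower : ∀ {k d} → k Fin.< i → d ∈ block (add x j b q) k → d Fin.< a
    above-lower k<i d∈ with ∈-add⁻ q d∈
    ... | inj₁ d∈x = Addable.above-lower p k<i d∈x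
    ... | inj₂ (refl , refl) = ⊥-elim (j≮i k<i)
    below-upper : ∀ {k d} → i Fin.< k → d ∈ block (add x j b q) k → a Fin.< d
    below-upper {k} i<k d∈ with ∈-add⁻ q d∈
    ... | inj₁ d∈x = Addable.below-upper p i<k d∈x
    ... | inj₂ (refl , refl) with belowMax? x i a | least-β-in-last-block p least
    ...   | yes (e , e∈x , a<e) | _ = Fin.<-trans a<e (Addable.above-lower q i<k e∈x)
    ...   | no ¬below | in-last-block with in-last-block ¬below
    ...     | refl = ⊥-elim (ℕ.<⇒≱ i<k (Fin.≤fromℕ k))

  β-inner⊀β-last : ∀ (j : Fin l) {b c} → ¬ β (inject₁ j) b ≺ᴸ β (fromℕ l) c
  β-inner⊀β-last j (inj₁ last<j) = Fin.<-asym last<j (inject₁<fromℕ j)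
  β-inner⊀β-last j (inj₂ (j≡last , _)) = Fin.fromℕ≢inject₁ (sym j≡last)

  -- The least cover towards 𝟙 has an α-label or a β-label in the last block: a β-step in an
  -- inner block could be replaced by a smaller α-step into the next block.
  inner-β⊀least-to-𝟙 : ∀ {z z′} (j : Fin l) {b} → LeastCover ⟨ z ⟩ 𝟙 z′ → ¬ β (inject₁ j) b ≺ᴸ lab n l ⟨ z ⟩ z′
  inner-β⊀least-to-𝟙 {z′ = 𝟘} _ lc = ⊥-elim (proj₁ (proj₁ (LeastCover.cover lc)))
  inner-β⊀least-to-𝟙 {z′ = 𝟙} j _ = β-inner⊀β-last j
  inner-β⊀least-to-𝟙 {z} {⟨ w ⟩} j lc with cover-is-add (LeastCover.cover lc)
  ... | k , c , r , refl rewrite lab-add r with belowMax? z k c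
  ...   | yes _ = λ ()
  ...   | no ¬below with view k
  ...     | ‵fromℕ = β-inner⊀β-last j
  ...     | ‵inject₁ k′ with addable-next-block k′ r ¬below
  ...       | r′ , below′ = ⊥-elim (subst IsAlpha (trans (lab-add r) (addLabel-β {z} ¬below))
                                      (least-label-α-shaped lc (r′ , tt) below′))

  -- The least label above add x j b q is at most that of adding a to block i, which is at most
  -- addLabel x i a.
  other-addition-not-increasing : ∀ {x y i a j b} (q : Addable x j b) → addLabel x i a ≺ᴸ addLabel x j b →
                                  AddableWithin (add x j b q) y (i , a) →
                                  ∀ {z′} → LeastCover ⟨ add x j b q ⟩ y z′ →
                                  ¬ addLabel x j b ≺ᴸ lab n l ⟨ add x j b q ⟩ z′
  other-addition-not-increasing {x} {i = i} {a} {j} {b} q ia≺jb (r , add≤y) {z′} lc jb≺ =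
    ≺-asym ia≺jb (≺-≼-trans jb≺ (≼-trans least≼ia (addLabel-antitone {x} {add x j b q} (≤-add q) i a)))
    where
    least≼ia : lab n l ⟨ add x j b q ⟩ z′ ≼ᴸ addLabel (add x j b q) i a
    least≼ia = subst (lab n l ⟨ add x j b q ⟩ z′ ≼ᴸ_) (lab-add r) (least-label-≼ lc (add-covers r) add≤y)

  earlier-not-below-max : ∀ {x i a j b} → j Fin.< i → addLabel x i a ≺ᴸ addLabel x j b → ¬ BelowMax x j b
  earlier-not-below-max {x} {i} {a} {j} {b} j<i ia≺jb below
    with belowMax? x i a | subst (addLabel x i a ≺ᴸ_) (addLabel-α {x} below) ia≺jb
  ... | yes _ | inj₁ i<j = Fin.<-asym i<j j<i
  ... | yes _ | inj₂ (refl , _) = Fin.<-irrefl refl j<i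
  ... | no _ | ()

  other-additions-not-increasing : ∀ {x y i a j b} ((p , _) : AddableWithin x y (i , a)) →
                                   LeastAddition x y (i , a) →
                                   ((q , _) : AddableWithin x y (j , b)) → (j , b) ≢ (i , a) →
                                   ∀ {z′} → LeastCover ⟨ add x j b q ⟩ y z′ →
                                   ¬ addLabel x j b ≺ᴸ lab n l ⟨ add x j b q ⟩ z′
  other-additions-not-increasing {y = 𝟘} (_ , ())
  other-additions-not-increasing {x} {⟨ y ⟩} {i} {a} (p , add≤y) least (q , addq≤y) jb≢ia =
    other-addition-not-increasing q (least (q , addq≤y) jb≢ia) (r , add-least {y = y} r addq≤y a∈y)
    where
    a∈y : a ∈ block y i
    a∈y = add≤y i (∈-add-new p)
    a∉ : a ∉ block (add x _ _ q) i
    a∉ a∈ with ∈-add⁻ q a∈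
    ... | inj₁ a∈x = Addable.fresh p a∈x
    ... | inj₂ (refl , refl) = jb≢ia refl
    r = addable-below {y = y} addq≤y a∈y a∉
  other-additions-not-increasing {x} {𝟙} {i} {a} {j} {b} (p , _) least (q , _) jb≢ia {z′} lc with j Fin.<? i
  ... | no j≮i =
    other-addition-not-increasing q (least (q , tt) jb≢ia) (still-addable p q least jb≢ia j≮i , tt) lc
  ... | yes j<i with earlier-not-below-max {x} j<i (least (q , tt) jb≢ia)
  ...   | ¬below with view j
  ...     | ‵fromℕ = ⊥-elim (ℕ.<⇒≱ j<i (Fin.≤fromℕ i))
  ...     | ‵inject₁ j′ =
    inner-β⊀least-to-𝟙 j′ lc ∘ subst (_≺ᴸ lab n l ⟨ add x _ b q ⟩ z′) (addLabel-β {x} ¬below)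

  -- Least covers above 𝟘

  -- The atom below y with the least label; the last two fields are what the comparisons with
  -- the labels right after 𝟘 need.
  record LeastAtom (y : RHat n l) : Set where
    field
      base : Fin (suc l) → Fin n
      increasing : StrictlyIncreasing base
      below : ⟨ atom base increasing ⟩ ≤ᴴ y
      pointwise-least : ∀ {b} (inc : StrictlyIncreasing b) → ⟨ atom b inc ⟩ ≤ᴴ y → ∀ i → base i Fin.≤ b i
      extensions-above : ∀ {j b} → AddableWithin (atom base increasing) y (j , b) → base j Fin.≤ b
      extensions-fit : ∀ {z k} → ⟨ z ⟩ ≤ᴴ y → (p : Addable z k (base k)) → ⟨ add z k (base k) p ⟩ ≤ᴴ y

    least-atom : R n l
    least-atom = atom base increasing

    first-difference-from : ∀ {b} (inc : StrictlyIncreasing b) → ⟨ atom b inc ⟩ ≢ ⟨ least-atom ⟩ →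
                            ∃ λ k → base k ≢ b k × (∀ {i} → i Fin.< k → base i ≡ b i)
    first-difference-from {b} inc b≢base =
      first-difference base b (λ base≗b → b≢base (cong ⟨_⟩ (atom-cong inc increasing (sym ∘ base≗b))))

    least-cover : LeastCover 𝟘 y ⟨ least-atom ⟩
    least-cover = record { cover = atom-⋖𝟘 base increasing ; below = below ; least = least }
      where
      least : ∀ z → 𝟘 ⋖ᴴ z → z ≤ᴴ y → z ≢ ⟨ least-atom ⟩ → lab n l 𝟘 ⟨ least-atom ⟩ ≺ᴸ lab n l 𝟘 z
      least 𝟘 ((_ , 𝟘≢𝟘) , _) = ⊥-elim (𝟘≢𝟘 refl)
      least 𝟙 (_ , nothing-between) = ⊥-elim (nothing-between (⟨ least-atom ⟩ , (tt , λ ()) , (tt , λ ())))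
      least ⟨ z ⟩ 𝟘⋖z z≤y z≢least with 𝟘⋖⇒atom 𝟘⋖z
      ... | b , inc , refl with first-difference-from inc z≢least
      ...   | k , basek≢bk , agree = atom-label-≺ increasing inc (pointwise-least inc z≤y) basek≢bk agree

    is-least-cover : ∀ {m} → LeastCover 𝟘 y m → m ≡ ⟨ least-atom ⟩
    is-least-cover lc = least-cover-unique ≺-asym lc least-cover

    -- Every element added to the least atom lies above the atom's element of its block, so the
    -- next label is a β.
    after-least-atom : ∀ {m′} → LeastCover ⟨ least-atom ⟩ y m′ →
                       lab n l 𝟘 ⟨ least-atom ⟩ ≺ᴸ lab n l ⟨ least-atom ⟩ m′
    after-least-atom {𝟘} lc′ = ⊥-elim (proj₁ (proj₁ (LeastCover.cover lc′)))
    after-least-atom {𝟙} _ = subst (_≺ᴸ β (fromℕ l) (fromℕ n)) (sym (lab-atom base increasing)) tt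
    after-least-atom {⟨ w ⟩} lc′ with cover-is-add (LeastCover.cover lc′)
    ... | j , b , q , refl =
      subst₂ _≺ᴸ_ (sym (lab-atom base increasing)) (sym (trans (lab-add q) (addLabel-β {least-atom} ¬below))) tt
      where
      ¬below : ¬ BelowMax least-atom j b
      ¬below (c , c∈ , b<c) =
        ℕ.<⇒≱ (subst (b Fin.<_) (∈-atom⁻ base {j} c∈) b<c) (extensions-above (q , LeastCover.below lc′))

    -- Another atom can still take the smaller element where it first differs from the least one,
    -- which yields an α-labelled cover above it.
    after-other-atom : ∀ {z z′} → 𝟘 ⋖ᴴ z → z ≤ᴴ y → z ≢ ⟨ least-atom ⟩ → LeastCover z y z′ →
                       ¬ lab n l 𝟘 z ≺ᴸ lab n l z z′
    after-other-atom {𝟘} ((_ , 𝟘≢𝟘) , _) = ⊥-elim (𝟘≢𝟘 refl)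
    after-other-atom {𝟙} (_ , nothing-between) =
      ⊥-elim (nothing-between (⟨ least-atom ⟩ , (tt , λ ()) , (tt , λ ())))
    after-other-atom {⟨ z ⟩} {z′} 𝟘⋖z z≤y z≢least lc′ with 𝟘⋖⇒atom 𝟘⋖z
    ... | b , inc , refl with first-difference-from inc z≢least
    ...   | k , basek≢bk , agree =
      IsAlpha⇒ι⊀ (least-label-α-shaped lc′ (p , extensions-fit z≤y p) (b k , ∈-atom⁺ b k , basek<bk))
      ∘ subst (_≺ᴸ lab n l ⟨ atom b inc ⟩ z′) (lab-atom b inc)
      where
      basek<bk : base k Fin.< b k
      basek<bk = Fin.≤∧≢⇒< (pointwise-least inc z≤y k) basek≢bk
      p : Addable (atom b inc) k (base k)
      p = record
        { fresh = λ basek∈ → basek≢bk (∈-atom⁻ b basek∈)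
        ; above-lower = λ {j} j<k c∈ →
            subst (Fin._< base k) (sym (trans (∈-atom⁻ b {j} c∈) (sym (agree j<k)))) (increasing j<k)
        ; below-upper = λ {j} k<j c∈ →
            Fin.<-trans basek<bk (subst (b k Fin.<_) (sym (∈-atom⁻ b {j} c∈)) (inc k<j)) }

    increasing-after : ∀ {m m′} → LeastCover 𝟘 y m → LeastCover m y m′ → lab n l 𝟘 m ≺ᴸ lab n l m m′
    increasing-after lc lc′ with is-least-cover lc
    ... | refl = after-least-atom lc′

    others-not-increasing : ∀ {m z z′} → LeastCover 𝟘 y m → 𝟘 ⋖ᴴ z → z ≤ᴴ y → z ≢ m → LeastCover z y z′ →
                            ¬ lab n l 𝟘 z ≺ᴸ lab n l z z′
    others-not-increasing lc 𝟘⋖z z≤y z≢m lc′ with is-least-cover lc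
    ... | refl = after-other-atom 𝟘⋖z z≤y z≢m lc′

  block-minimum : ∀ y i → ∃ λ c → c ∈ block y i × (∀ {d} → d ∈ block y i → c Fin.≤ d)
  block-minimum y i with least-satisfying (_∈? block y i) (block-nonempty y i)
  ... | c , c∈ , none-below = c , c∈ , λ d∈ → ℕ.≮⇒≥ (λ d<c → none-below d<c d∈)

  minima : R n l → Fin (suc l) → Fin n
  minima y i = proj₁ (block-minimum y i)

  min-atom : ∀ y → LeastAtom ⟨ y ⟩
  min-atom y = record
    { base = minima y
    ; increasing = λ i<j → blocks-ordered y i<j (min∈ _) (min∈ _)
    ; below = λ i c∈ → subst (_∈ block y i) (sym (∈-atom⁻ (minima y) {i} c∈)) (min∈ i)
    ; pointwise-least = λ {b} _ atom≤y i → min≤ i (atom≤y i (∈-atom⁺ b i))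
    ; extensions-above = λ { {j} (q , add≤y) → min≤ j (add≤y j (∈-add-new q)) }
    ; extensions-fit = λ z≤y p → add-least {y = y} p z≤y (min∈ _) }
    where
    min∈ : ∀ i → minima y i ∈ block y i
    min∈ i = proj₁ (proj₂ (block-minimum y i))
    min≤ : ∀ i {d} → d ∈ block y i → minima y i Fin.≤ d
    min≤ i = proj₂ (proj₂ (block-minimum y i))

  module _ (l<n : l ℕ.< n) where

    first : Fin (suc l) → Fin n
    first i = Fin.fromℕ< (ℕ.≤-<-trans (Fin.toℕ≤pred[n] i) l<n)

    toℕ-first : ∀ i → toℕ (first i) ≡ toℕ i
    toℕ-first i = Fin.toℕ-fromℕ< (ℕ.≤-<-trans (Fin.toℕ≤pred[n] i) l<n)

    first-increasing : StrictlyIncreasing first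
    first-increasing {i} {j} = subst₂ ℕ._<_ (sym (toℕ-first i)) (sym (toℕ-first j))

    -- If b < first j could be added to block j, it would have to exceed first b, which is b itself.
    first-atom : LeastAtom 𝟙
    first-atom = record
      { base = first
      ; increasing = first-increasing
      ; below = tt
      ; pointwise-least = λ {b} inc _ i → subst (ℕ._≤ toℕ (b i)) (sym (toℕ-first i)) (increasing⇒index≤ b inc i)
      ; extensions-above = λ { {j} {b} (q , _) → ℕ.≮⇒≥ (λ b<first → not-above q b<first) }
      ; extensions-fit = λ _ _ → tt }
      where
      not-above : ∀ {j b} → Addable (atom first first-increasing) j b → b Fin.< first j → ⊥
      not-above {j} {b} q b<first = ℕ.<-irrefl (trans (toℕ-first j₀) toℕ-j₀)
                                      (Addable.above-lower q j₀<j (∈-atom⁺ first j₀))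
        where
        b<j : toℕ b ℕ.< toℕ j
        b<j = subst (toℕ b ℕ.<_) (toℕ-first j) b<first
        j₀ : Fin (suc l)
        j₀ = Fin.fromℕ< (ℕ.<-trans b<j (Fin.toℕ<n j))
        toℕ-j₀ : toℕ j₀ ≡ toℕ b
        toℕ-j₀ = Fin.toℕ-fromℕ< (ℕ.<-trans b<j (Fin.toℕ<n j))
        j₀<j : j₀ Fin.< j
        j₀<j = subst (ℕ._< toℕ j) (sym toℕ-j₀) b<j

  least-atom-below : ∀ {y} → l ℕ.< n → 𝟘 ≢ y → LeastAtom y
  least-atom-below {𝟘} _ 𝟘≢𝟘 = ⊥-elim (𝟘≢𝟘 refl)
  least-atom-below {⟨ y ⟩} _ _ = min-atom y
  least-atom-below {𝟙} l<n _ = first-atom l<n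

  ¬𝟙⋖ : ∀ {z} → ¬ 𝟙 ⋖ᴴ z
  ¬𝟙⋖ {𝟘} ((() , _) , _)
  ¬𝟙⋖ {⟨ _ ⟩} ((() , _) , _)
  ¬𝟙⋖ {𝟙} ((_ , 𝟙≢𝟙) , _) = 𝟙≢𝟙 refl

  least-cover-exists : l ℕ.< n → ∀ {x y} → x ≤ᴴ y → x ≢ y → Σ (RHat n l) (LeastCover x y)
  least-cover-exists l<n {𝟘} _ 𝟘≢y = _ , LeastAtom.least-cover (least-atom-below l<n 𝟘≢y)
  least-cover-exists _ {⟨ _ ⟩} x≤y x≢y = least-cover-above x≤y x≢y
  least-cover-exists _ {𝟙} {𝟙} _ 𝟙≢𝟙 = ⊥-elim (𝟙≢𝟙 refl)

  element-least-covers-increase : ∀ {x y m m′} → LeastCover ⟨ x ⟩ y m → LeastCover m y m′ →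
                                  lab n l ⟨ x ⟩ m ≺ᴸ lab n l m m′
  element-least-covers-increase {m = 𝟘} lc _ = ⊥-elim (proj₁ (proj₁ (LeastCover.cover lc)))
  element-least-covers-increase {m = 𝟙} _ lc′ = ⊥-elim (¬𝟙⋖ (LeastCover.cover lc′))
  element-least-covers-increase {m = ⟨ _ ⟩} {m′} lc lc′ with cover-is-add (LeastCover.cover lc)
  ... | _ , _ , p , refl = subst (_≺ᴸ lab n l ⟨ add _ _ _ p ⟩ m′) (sym (lab-add p))
    (least-addition-then-increasing (p , LeastCover.below lc) (least-cover⇒least-addition p lc) lc′)

  least-covers-increase : l ℕ.< n → ∀ {x y m m′} → LeastCover x y m → LeastCover m y m′ →
                          lab n l x m ≺ᴸ lab n l m m′
  least-covers-increase l<n {𝟘} lc = LeastAtom.increasing-after (least-atom-below l<n (least-cover⇒≢ lc)) lc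
  least-covers-increase _ {⟨ _ ⟩} = element-least-covers-increase
  least-covers-increase _ {𝟙} lc = ⊥-elim (¬𝟙⋖ (LeastCover.cover lc))

  element-other-covers-not-increasing : ∀ {x y m z z′} → LeastCover ⟨ x ⟩ y m → ⟨ x ⟩ ⋖ᴴ z → z ≤ᴴ y → z ≢ m →
                                        LeastCover z y z′ → ¬ lab n l ⟨ x ⟩ z ≺ᴸ lab n l z z′
  element-other-covers-not-increasing {z = 𝟘} _ ((() , _) , _)
  element-other-covers-not-increasing {m = 𝟘} lc = ⊥-elim (proj₁ (proj₁ (LeastCover.cover lc)))
  element-other-covers-not-increasing {m = 𝟙} {z = 𝟙} _ _ _ 𝟙≢𝟙 = ⊥-elim (𝟙≢𝟙 refl)
  element-other-covers-not-increasing {m = 𝟙} {z = ⟨ _ ⟩} lc x⋖z with cover-is-add x⋖z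
  ... | i , a , p , _ = ⊥-elim (⋖𝟙⇒maximal (LeastCover.cover lc) i a p)
  element-other-covers-not-increasing {m = ⟨ _ ⟩} {z = 𝟙} lc x⋖𝟙 with cover-is-add (LeastCover.cover lc)
  ... | i , a , p , _ = ⊥-elim (⋖𝟙⇒maximal x⋖𝟙 i a p)
  element-other-covers-not-increasing {m = ⟨ _ ⟩} {z = ⟨ _ ⟩} {z′} lc x⋖z z≤y z≢m lc′
    with cover-is-add (LeastCover.cover lc) | cover-is-add x⋖z
  ... | _ , _ , p , refl | _ , _ , q , refl =
    other-additions-not-increasing (p , LeastCover.below lc) (least-cover⇒least-addition p lc) (q , z≤y)
      (λ { refl → z≢m refl }) lc′
    ∘ subst (_≺ᴸ lab n l ⟨ add _ _ _ q ⟩ z′) (lab-add q)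

  other-covers-not-increasing : l ℕ.< n → ∀ {x y m z z′} → LeastCover x y m → x ⋖ᴴ z → z ≤ᴴ y → z ≢ m →
                                LeastCover z y z′ → ¬ lab n l x z ≺ᴸ lab n l z z′
  other-covers-not-increasing l<n {𝟘} lc =
    LeastAtom.others-not-increasing (least-atom-below l<n (least-cover⇒≢ lc)) lc
  other-covers-not-increasing _ {⟨ _ ⟩} = element-other-covers-not-increasing
  other-covers-not-increasing _ {𝟙} lc = ⊥-elim (¬𝟙⋖ (LeastCover.cover lc))

theorem2p9 : ∀ (n l : ℕ) → l < n →
    IsELLabeling (_≤̂_ n l) (_≺_ n l) (lab n l)
theorem2p9 n l l<n =
  el-labeling (least-cover-exists l<n) (least-covers-increase l<n) (other-covers-not-increasing l<n)
  where open RHatPoset n l
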